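{- Let $\Gamma$ be a simple connected cubic girth-regular graph of girth $g$ with $n$ vertices and signature $(1,1,2)$. Then $g$ is even and $\Gamma$ is isomorphic to the truncation $\mathrm{Tr}(\mathcal{M})$ of some map $\mathcal{M}$ all of whose face cycles have length $g/2$. In particular, $g/2$ divides $n$. Moreover, if $\Gamma$ is vertex-transitive, then $\mathcal{M}$ is an arc-transitive $\{g/2,\ell\}$-map for some $\ell>g$.
   Context: Cubic means $3$-regular. For a graph of finite girth $g$, a girth cycle is a cycle of length $g$, and $\epsilon(e)$ is the number of girth cycles containing the edge $e$. The signature of a vertex $v$ with incident edges $e_1,\ldots,e_k$ ordered so that $\epsilon(e_1)\le\cdots\le\epsilon(e_k)$ is $(\epsilon(e_1),\ldots,\epsilon(e_k))$; a graph is girth-regular if all vertices have the same signature (the signature of the graph). Graphs underlying maps may have parallel edges and loops: such a graph is $(V,E,\partial)$ with $\partial:E\to\{X\subseteq V:|X|\le2\}$; each edge consists of two mutually inverse arcs, each with a tail. A map: view a connected graph $\Lambda$ as a $1$-dimensional CW complex and, for a set of simple closed walks (closed walks using each edge at most once), attach one disk per walk along the closed curve of the walk (injectively except over vertices); if the result is a closed surface it is a map with skeleton $\Lambda$ and face cycles the given walks. A $\{m,k\}$-map has $k$-regular skeleton and all face cycles of length $m$. An automorphism of a map is a permutation of flags induced by a homeomorphism of the surface preserving the embedded graph; the map is arc-transitive if its automorphism group acts transitively on the arcs of the skeleton. The dihedral scheme of a map: $s\leftrightarrow t$ iff arcs $s,t$ have a common tail and their underlying edges are consecutive edges of some face cycle.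 The truncation $\mathrm{Tr}(\mathcal{M})$ is the simple graph whose vertices are the arcs of the skeleton, with $s,t$ adjacent iff $s\leftrightarrow t$ or $s,t$ are mutually inverse. -}

module Defs where

open import Data.Nat using (ℕ; zero; suc; _+_; _<_; _≤ᵇ_)
open import Data.Bool using (Bool; true; false; _∧_; not; if_then_else_)
open import Data.Fin using (Fin; _≟_)
open import Data.List using (List; []; _∷_; length; map; concatMap; filterᵇ; allFin; [_])
open import Data.List.Relation.Binary.Permutation.Propositional using (_↭_)
open import Data.Product using (Σ; _×_; _,_)
open import Data.Sum using (_⊎_)
open import Relation.Nullary using (¬_; does)
open import Relation.Binary.PropositionalEquality using (_≡_; _≢_)
open import Relation.Binary.Construct.Closure.ReflexiveTransitive using (Star)
open import Function using (_∘_)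

record Graph (n : ℕ) : Set where
  field
    adj    : Fin n → Fin n → Bool
    sym    : ∀ u v → adj u v ≡ adj v u
    irrefl : ∀ v → adj v v ≡ false
open Graph public

module _ {n : ℕ} (G : Graph n) where

  neighbours : Fin n → List (Fin n)
  neighbours v = filterᵇ (adj G v) (allFin n)

  Cubic : Set
  Cubic = ∀ v → length (neighbours v) ≡ 3

  data Edge : Fin n → Fin n → Set where
    edge : ∀ {u v} → adj G u v ≡ true → Edge u v

  Connected : Set
  Connected = ∀ u v → Star Edge u v

  notIn : Fin n → List (Fin n) → Bool
  notIn x []       = true
  notIn x (y ∷ ys) = not (does (x ≟ y)) ∧ notIn x ys

  allDistinct : List (Fin n) → Bool
  allDistinct []       = true
  allDistinct (x ∷ xs) = notIn x xs ∧ allDistinct xs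

  pathTo : Fin n → List (Fin n) → Bool
  pathTo first []           = true
  pathTo first (x ∷ [])     = adj G x first
  pathTo first (x ∷ y ∷ ys) = adj G x y ∧ pathTo first (y ∷ ys)

  -- w = (v₀, …, v_{k-1}) is (a cyclic traversal of) a cycle of length k:
  -- k ≥ 3, distinct vertices, v_i ~ v_{i+1} and v_{k-1} ~ v₀.
  isCycle : List (Fin n) → Bool
  isCycle []       = false
  isCycle (x ∷ xs) = (3 ≤ᵇ length (x ∷ xs)) ∧ allDistinct (x ∷ xs) ∧ pathTo x (x ∷ xs)

  seqs : ℕ → List (List (Fin n))
  seqs zero    = [ [] ]
  seqs (suc k) = concatMap (λ a → map (a ∷_) (seqs k)) (allFin n)

  HasGirth : ℕ → Set
  HasGirth g = Σ (List (Fin n)) (λ w → length w ≡ g × isCycle w ≡ true)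
             × (∀ w → isCycle w ≡ true → g Data.Nat.≤ length w)

  -- ε({u,v}) for an edge uv: the number of girth cycles through uv.
  -- Each cycle through uv has exactly one traversal (u, v, w₂, …, w_{g-1}),
  -- so we count those traversals.
  ε : ℕ → Fin n → Fin n → ℕ
  ε g u v = length (filterᵇ (λ w → isCycle (u ∷ v ∷ w)) (seqs (g Data.Nat.∸ 2)))

  GirthRegular112 : ℕ → Set
  GirthRegular112 g = ∀ v → map (ε g v) (neighbours v) ↭ (1 ∷ 1 ∷ 2 ∷ [])

  VertexTransitive : Set
  VertexTransitive = ∀ u v → Σ (Fin n → Fin n) λ σ → Σ (Fin n → Fin n) λ τ →
      (∀ x → τ (σ x) ≡ x) × (∀ x → σ (τ x) ≡ x)
    × (∀ a b → adj G (σ a) (σ b) ≡ adj G a b) × σ u ≡ v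

-- Maps, combinatorially: flag systems (possibly non-orientable)

iter : ∀ {A : Set} → (A → A) → ℕ → A → A
iter f zero    x = x
iter f (suc k) x = f (iter f k x)

IsPeriod : ∀ {A : Set} → (A → A) → A → ℕ → Set
IsPeriod f x m = 0 < m × iter f m x ≡ x × (∀ k → 0 < k → k < m → iter f k x ≢ x)

data FlagStep {N : ℕ} (r₀ r₁ r₂ : Fin N → Fin N) : Fin N → Fin N → Set where
  s₀ : ∀ {x} → FlagStep r₀ r₁ r₂ x (r₀ x)
  s₁ : ∀ {x} → FlagStep r₀ r₁ r₂ x (r₁ x)
  s₂ : ∀ {x} → FlagStep r₀ r₁ r₂ x (r₂ x)

data FaceStep {N : ℕ} (r₀ r₁ : Fin N → Fin N) : Fin N → Fin N → Set where
  f₀ : ∀ {x} → FaceStep r₀ r₁ x (r₀ x)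
  f₁ : ∀ {x} → FaceStep r₀ r₁ x (r₁ x)

-- Flags are (vertex, edge, face) incidences; r₀ changes the vertex,
-- r₁ the edge, r₂ the face.
record Map (N : ℕ) : Set where
  field
    r₀ r₁ r₂   : Fin N → Fin N
    inv₀       : ∀ x → r₀ (r₀ x) ≡ x
    inv₁       : ∀ x → r₁ (r₁ x) ≡ x
    inv₂       : ∀ x → r₂ (r₂ x) ≡ x
    fpf₀       : ∀ x → r₀ x ≢ x
    fpf₁       : ∀ x → r₁ x ≢ x
    fpf₂       : ∀ x → r₂ x ≢ x
    comm₀₂     : ∀ x → r₀ (r₂ x) ≡ r₂ (r₀ x)
    fpf₀₂      : ∀ x → r₀ (r₂ x) ≢ x
    connected  : ∀ x y → Star (FlagStep r₀ r₁ r₂) x y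
    -- face cycles are simple closed walks (no edge used twice by a face)
    simpleFace : ∀ x → ¬ Star (FaceStep r₀ r₁) x (r₂ x)
open Map public

module _ {N : ℕ} (M : Map N) where

  -- flags x, y lie on the same arc (arcs = ⟨r₂⟩-orbits)
  SameArc : Fin N → Fin N → Set
  SameArc x y = y ≡ x ⊎ y ≡ r₂ M x

  -- adjacency in Tr(M), lifted to flags: the arcs are distinct and either
  -- mutually inverse (r₀) or related by the dihedral scheme (r₁: common
  -- tail, consecutive edges of a face at that tail)
  TrAdj : Fin N → Fin N → Set
  TrAdj x y = ¬ SameArc x y × Σ (Fin N) λ x' → Σ (Fin N) λ y' →
    SameArc x x' × SameArc y y' × (y' ≡ r₀ M x' ⊎ y' ≡ r₁ M x')

  FacesOfLength : ℕ → Set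
  FacesOfLength m = ∀ x → IsPeriod (r₁ M ∘ r₀ M) x m

  SkeletonRegular : ℕ → Set
  SkeletonRegular ℓ = ∀ x → IsPeriod (r₂ M ∘ r₁ M) x ℓ

  IsMapAut : (Fin N → Fin N) → Set
  IsMapAut α = Σ (Fin N → Fin N) λ β → (∀ x → β (α x) ≡ x) × (∀ x → α (β x) ≡ x)
    × (∀ x → α (r₀ M x) ≡ r₀ M (α x)) × (∀ x → α (r₁ M x) ≡ r₁ M (α x))
    × (∀ x → α (r₂ M x) ≡ r₂ M (α x))

  ArcTransitive : Set
  ArcTransitive = ∀ x y → Σ (Fin N → Fin N) λ α → IsMapAut α × SameArc (α x) y

-- Γ ≅ Tr(M): a map φ from flags onto vertices of Γ whose fibres are exactly
-- the arcs (so φ induces a bijection arcs → V(Γ)) and which carries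
-- Tr-adjacency to adjacency in Γ.
TrIso : ∀ {n N} → Graph n → Map N → Set
TrIso {n} {N} G M = Σ (Fin N → Fin n) λ φ →
    (∀ v → Σ (Fin N) λ x → φ x ≡ v)
  × (∀ x y → (φ x ≡ φ y → SameArc M x y) × (SameArc M x y → φ x ≡ φ y))
  × (∀ x y → (adj G (φ x) (φ y) ≡ true → TrAdj M x y) × (TrAdj M x y → adj G (φ x) (φ y) ≡ true))

{-# OPTIONS --safe #-}
module Submission where

-- In a cubic graph of signature (1,1,2) every vertex v has one neighbour, its partner, joined to v by an edge on
-- two girth cycles, and two neighbours joined by edges on one girth cycle each (ε₁-edges).  Counting girth cycles
-- shows that every girth cycle through v uses the partner edge of v; so partnership is a perfect matching and
-- girth cycles alternate between matching edges and ε₁-edges.  Take as flags the ordered ε₁-edges, with r₂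
-- swapping the two ε₁-edges at a vertex, r₁ reversing an ε₁-edge and r₀ following the matching edge along the
-- girth cycle of the flag.  This is a map whose arcs are the vertices of Γ and whose truncation is Γ; its faces
-- are the girth cycles, advanced two vertices per step, so g is even, faces have length g/2, and grouping the
-- flags by face gives g ∣ 2n.  Graph automorphisms lift to map automorphisms, and r₂ r₁ walks along a cycle of
-- ε₁-edges, which is longer than g because it contains no matching edge.

open import Data.Bool using (Bool; true; false; not; _∧_; if_then_else_)
open import Data.Bool.Properties using (∧-conicalˡ; ∧-conicalʳ; T-≡; not-involutive; not-¬)
open import Data.Empty using (⊥; ⊥-elim)
open import Data.Fin using (Fin; toℕ; _≟_; join; splitAt)
open import Data.Fin.Properties using (pigeonhole; splitAt-join; join-splitAt)
open import Data.List using (List; []; _∷_; _++_; _∷ʳ_; length; map; reverse; filter; filterᵇ; allFin; drop; take; initLast; _∷ʳ′_)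
open import Data.List.Properties
  using ( ∷-injective; ∷-injectiveˡ; ∷-injectiveʳ; ∷ʳ-injectiveʳ; ++-assoc; ++-identityʳ; length-++; length-map
        ; length-take; length-filter; length-tabulate; length-reverse; map-++; map-∘; map-cong; map-id; map-injective
        ; reverse-map; reverse-++; reverse-involutive; reverse-injective; unfold-reverse; take++drop≡id )
open import Data.List.Membership.Propositional using (_∈_; _∉_)
open import Data.List.Membership.Propositional.Properties
  using (∈-∃++; ∈-concat⁺′; ∈-concat⁻′; ∈-map⁺; ∈-map⁻; ∈-filter⁺; ∈-filter⁻; ∈-allFin; ∈-++⁺ʳ; ∈-++⁻)
open import Data.List.Membership.Propositional.Properties.WithK using (unique∧set⇒bag)
open import Data.List.Relation.Unary.All as All using (All; []; _∷_)
import Data.List.Relation.Unary.All.Properties as All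
open import Data.List.Relation.Unary.Any using (here; there)
open import Data.List.Relation.Unary.Unique.Propositional using (Unique; []; _∷_)
import Data.List.Relation.Unary.Unique.Propositional.Properties as Unique
open import Data.List.Relation.Binary.BagAndSetEquality using (∼bag⇒↭)
open import Data.List.Relation.Binary.Permutation.Propositional using (_↭_; ↭-refl; ↭-sym; ↭-trans; prep; swap; ↭⇒↭ₛ)
open import Data.List.Relation.Binary.Permutation.Propositional.Properties using (∈-resp-↭; ↭-length; ↭-reverse; ∷↭∷ʳ)
import Data.List.Relation.Binary.Permutation.Setoid.Properties as Permₛ
open import Data.Nat using (ℕ; zero; suc; _+_; _*_; _∸_; _≤_; _<_; _≤ᵇ_; z≤n; s≤s; _/_)
open import Data.Nat.DivMod using (m*n/n≡m)
open import Data.Nat.Divisibility using (_∣_; divides; _∣0; ∣-refl; ∣m∣n⇒∣m+n; *-cancelˡ-∣)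
open import Data.Nat.ListAction.Properties using (sum-↭)
open import Data.Nat.Properties
  using ( suc-injective; +-comm; +-suc; +-identityʳ; *-comm; ≤-refl; ≤-reflexive; ≤-trans; <-≤-trans; <⇒≤; <⇒≱; ≤∧≢⇒<
        ; n<1+n; n≤1+n; m<n⇒m<1+n; m<1+n⇒m≤n; m<1+n⇒m<n∨m≡n; m≤n⇒m<n∨m≡n; m<m+n; m≤n+m; m<n⇒0<n∸m; m∸n≤m
        ; m+[n∸m]≡n; m≤n⇒m⊓n≡m; ≤ᵇ⇒≤; ≤⇒≤ᵇ )
open import Data.Product as Product using (Σ; _×_; _,_; proj₁; proj₂)
open import Data.Sum using (_⊎_; inj₁; inj₂; [_,_]′)
open import Data.Unit using (⊤; tt)
open import Function using (_∘_; id; const; mk⇔; Equivalence)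
open import Relation.Binary using (Decidable; IsEquivalence)
open import Relation.Binary.PropositionalEquality
open import Relation.Binary.Construct.Closure.ReflexiveTransitive using (Star; _◅_; _◅◅_) renaming (ε to [])
open import Relation.Nullary using (¬_; Dec; yes; no; ¬?; contradiction; does)
open import Relation.Nullary.Decidable using (T?; dec-true; dec-false; _×-dec_)
open import Defs hiding (sym; r₀; r₁; r₂)

≡⊎≡not : ∀ a b → a ≡ b ⊎ a ≡ not b
≡⊎≡not true  true  = inj₁ refl
≡⊎≡not false false = inj₁ refl
≡⊎≡not true  false = inj₂ refl
≡⊎≡not false true  = inj₂ refl

module _ {P : ℕ → Set} (P? : ∀ k → Dec (P k)) where

  private
    leastBelow : ∀ K → (∀ j → j < K → ¬ P j) ⊎ (Σ ℕ λ k → k < K × P k × (∀ j → j < k → ¬ P j))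
    leastBelow zero = inj₁ (λ _ ())
    leastBelow (suc K) with leastBelow K
    ... | inj₂ (k , k<K , pk , below) = inj₂ (k , m<n⇒m<1+n k<K , pk , below)
    ... | inj₁ none with P? K
    ...   | yes pK = inj₂ (K , n<1+n K , pK , none)
    ...   | no ¬pK = inj₁ λ j j<1+K → [ none j , (λ { refl → ¬pK }) ]′ (m<1+n⇒m<n∨m≡n j<1+K)

  least : ∀ {K} → P K → Σ ℕ λ k → k ≤ K × P k × (∀ j → j < k → ¬ P j)
  least {K} pK with leastBelow (suc K)
  ... | inj₁ none                    = contradiction pK (none K (n<1+n K))
  ... | inj₂ (k , k<1+K , pk , below) = k , m<1+n⇒m≤n k<1+K , pk , below

double : ℕ → ℕ
double zero    = zero
double (suc k) = suc (suc (double k))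

double≡*2 : ∀ k → double k ≡ k * 2
double≡*2 zero    = refl
double≡*2 (suc k) = cong (suc ∘ suc) (double≡*2 k)

double-mono-< : ∀ {k j} → k < j → suc (double k) ≤ double j
double-mono-< {zero}  {suc j} _         = s≤s z≤n
double-mono-< {suc k} {suc j} (s≤s k<j) = s≤s (s≤s (double-mono-< k<j))

even⊎odd : ∀ m → Σ ℕ λ k → m ≡ double k ⊎ m ≡ suc (double k)
even⊎odd zero = 0 , inj₁ refl
even⊎odd (suc m) with even⊎odd m
... | k , inj₁ e = k , inj₂ (cong suc e)
... | k , inj₂ o = suc k , inj₁ (cong suc o)

module _ {A : Set} (f : A → A) where

  iter-+ : ∀ m n x → iter f (m + n) x ≡ iter f m (iter f n x)
  iter-+ zero    n x = refl
  iter-+ (suc m) n x = cong f (iter-+ m n x)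

  iter-suc : ∀ k x → iter f (suc k) x ≡ iter f k (f x)
  iter-suc zero    x = refl
  iter-suc (suc k) x = cong f (iter-suc k x)

module _ {A : Set} (f : A → A) {f⁻¹ : A → A} (left : ∀ x → f⁻¹ (f x) ≡ x) where

  iter-cancel : ∀ k x → iter f⁻¹ k (iter f k x) ≡ x
  iter-cancel zero    x = refl
  iter-cancel (suc k) x = begin
    iter f⁻¹ (suc k) (f (iter f k x))   ≡⟨ iter-suc f⁻¹ k _ ⟩
    iter f⁻¹ k (f⁻¹ (f (iter f k x)))   ≡⟨ cong (iter f⁻¹ k) (left _) ⟩
    iter f⁻¹ k (iter f k x)             ≡⟨ iter-cancel k x ⟩
    x                                   ∎
    where open ≡-Reasoning

  iter-injective : ∀ k {x y} → iter f k x ≡ iter f k y → x ≡ y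
  iter-injective k {x} {y} e = trans (sym (iter-cancel k x)) (trans (cong (iter f⁻¹ k) e) (iter-cancel k y))

iter-conj : ∀ {A B : Set} {f : A → A} {f′ : B → B} (α : A → B) → (∀ z → α (f z) ≡ f′ (α z)) →
  ∀ k x → iter f′ k (α x) ≡ α (iter f k x)
iter-conj α comm zero    x = refl
iter-conj {f′ = f′} α comm (suc k) x = trans (cong f′ (iter-conj α comm k x)) (sym (comm _))

IsPeriod-conj : ∀ {A B : Set} {f : A → A} {f′ : B → B} (α : A → B) (β : B → A) → (∀ z → β (α z) ≡ z) →
  (∀ z → α (f z) ≡ f′ (α z)) → ∀ {x m} → IsPeriod f x m → IsPeriod f′ (α x) m
IsPeriod-conj α β βα comm {x} {m} (0<m , back , minimal) =
  0<m , trans (iter-conj α comm m x) (cong α back) ,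
  λ k 0<k k<m e → minimal k 0<k k<m (trans (sym (βα _)) (trans (cong β (trans (sym (iter-conj α comm k x)) e)) (βα x)))

IsPeriod-inverse : ∀ {A : Set} {f f⁻¹ : A → A} → (∀ x → f⁻¹ (f x) ≡ x) → (∀ x → f (f⁻¹ x) ≡ x) →
  ∀ {x m} → IsPeriod f x m → IsPeriod f⁻¹ x m
IsPeriod-inverse {A} {f} {f⁻¹} left right {x} {m} (0<m , back , minimal) =
  0<m , undo f {f⁻¹} left m back , λ k 0<k k<m e → minimal k 0<k k<m (undo f⁻¹ {f} right k e)
  where
  undo : ∀ (g : A → A) {h} → (∀ z → h (g z) ≡ z) → ∀ k → iter g k x ≡ x → iter h k x ≡ x
  undo g {h} hg k e = trans (cong (iter h k) (sym e)) (iter-cancel g hg k x)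

period : ∀ {N} (f f⁻¹ : Fin N → Fin N) → (∀ x → f⁻¹ (f x) ≡ x) →
  ∀ x → Σ ℕ λ m → IsPeriod f x m
period {N} f f⁻¹ left x with pigeonhole (n<1+n N) (λ i → iter f (toℕ i) x)
... | i , j , i<j , eq = shortest (m<n⇒0<n∸m i<j) returns
  where
  d = toℕ j ∸ toℕ i
  returns : iter f d x ≡ x
  returns = sym (iter-injective f {f⁻¹} left (toℕ i) (begin
    iter f (toℕ i) x            ≡⟨ eq ⟩
    iter f (toℕ j) x            ≡⟨ cong (λ k → iter f k x) (sym (m+[n∸m]≡n (<⇒≤ i<j))) ⟩
    iter f (toℕ i + d) x        ≡⟨ iter-+ f (toℕ i) d x ⟩
    iter f (toℕ i) (iter f d x) ∎))
    where open ≡-Reasoning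
  shortest : ∀ {d} → 0 < d → iter f d x ≡ x → Σ ℕ λ m → IsPeriod f x m
  shortest {suc d} _ back with least (λ k → iter f (suc k) x ≟ x) {d} back
  ... | k , _ , pk , below = suc k , s≤s z≤n , pk , λ { (suc k′) _ (s≤s k′<k) → below k′ k′<k }

module _ {A : Set} where

  Unique-resp-↭ : ∀ {xs ys : List A} → xs ↭ ys → Unique xs → Unique ys
  Unique-resp-↭ p = Permₛ.Unique-resp-↭ (setoid A) (↭⇒↭ₛ p)

  Unique-++⁻ˡ : ∀ xs {ys : List A} → Unique (xs ++ ys) → Unique xs
  Unique-++⁻ˡ []       _          = []
  Unique-++⁻ˡ (x ∷ xs) (x∉ ∷ xs!) = All.++⁻ˡ xs x∉ ∷ Unique-++⁻ˡ xs xs!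

  Unique-++⁻ʳ : ∀ xs {ys : List A} → Unique (xs ++ ys) → Unique ys
  Unique-++⁻ʳ []       ys!      = ys!
  Unique-++⁻ʳ (x ∷ xs) (_ ∷ u) = Unique-++⁻ʳ xs u

  Unique-++-disjoint : ∀ xs {ys : List A} {z} → Unique (xs ++ ys) → z ∈ xs → z ∉ ys
  Unique-++-disjoint (x ∷ xs) (x∉ ∷ _)  (here refl) z∈ys = All.lookup x∉ (∈-++⁺ʳ xs z∈ys) refl
  Unique-++-disjoint (x ∷ xs) (_ ∷ xs!) (there z∈)  z∈ys = Unique-++-disjoint xs xs! z∈ z∈ys

  Unique-head≢last : ∀ {y} mid {z : A} → Unique (y ∷ mid ∷ʳ z) → y ≢ z
  Unique-head≢last mid (y∉ ∷ _) y≡z = All.lookup y∉ (∈-++⁺ʳ mid (here refl)) y≡z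

  Unique-sameElements⇒length≡ : ∀ {xs ys : List A} → Unique xs → Unique ys →
    (∀ {z} → z ∈ xs → z ∈ ys) → (∀ {z} → z ∈ ys → z ∈ xs) → length xs ≡ length ys
  Unique-sameElements⇒length≡ xs! ys! to from = ↭-length (∼bag⇒↭ (unique∧set⇒bag xs! ys! (mk⇔ to from)))

  length≡3⇒ : ∀ (xs : List A) → length xs ≡ 3 → Σ A λ a → Σ A λ b → Σ A λ c → xs ≡ a ∷ b ∷ c ∷ []
  length≡3⇒ (a ∷ b ∷ c ∷ []) _ = a , b , c , refl
  length≡3⇒ []                        ()
  length≡3⇒ (_ ∷ [])                  ()
  length≡3⇒ (_ ∷ _ ∷ [])              ()
  length≡3⇒ (_ ∷ _ ∷ _ ∷ _ ∷ _)       ()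

  reverse-∷-∷ʳ : ∀ x ys (z : A) → reverse (x ∷ ys ∷ʳ z) ≡ z ∷ reverse ys ∷ʳ x
  reverse-∷-∷ʳ x ys z = begin
    reverse ((x ∷ ys) ∷ʳ z)   ≡⟨ reverse-++ (x ∷ ys) (z ∷ []) ⟩
    z ∷ reverse (x ∷ ys)      ≡⟨ cong (z ∷_) (unfold-reverse x ys) ⟩
    z ∷ reverse ys ∷ʳ x       ∎
    where open ≡-Reasoning

  rotate : List A → List A
  rotate []       = []
  rotate (x ∷ xs) = xs ∷ʳ x

  iter-rotate-++ : ∀ xs ys → iter rotate (length xs) (xs ++ ys) ≡ ys ++ xs
  iter-rotate-++ []       ys = sym (++-identityʳ ys)
  iter-rotate-++ (x ∷ xs) ys = begin
    iter rotate (suc (length xs)) (x ∷ xs ++ ys)  ≡⟨ iter-suc rotate (length xs) _ ⟩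
    iter rotate (length xs) ((xs ++ ys) ∷ʳ x)     ≡⟨ cong (iter rotate (length xs)) (++-assoc xs ys (x ∷ [])) ⟩
    iter rotate (length xs) (xs ++ ys ∷ʳ x)       ≡⟨ iter-rotate-++ xs (ys ∷ʳ x) ⟩
    (ys ∷ʳ x) ++ xs                               ≡⟨ ++-assoc ys (x ∷ []) xs ⟩
    ys ++ x ∷ xs                                  ∎
    where open ≡-Reasoning

  iter-rotate-length : ∀ xs → iter rotate (length xs) xs ≡ xs
  iter-rotate-length xs = trans (cong (iter rotate (length xs)) (sym (++-identityʳ xs))) (iter-rotate-++ xs [])

  drop-∷ : ∀ j (xs : List A) → j < length xs → Σ A λ d → Σ (List A) λ ds → drop j xs ≡ d ∷ ds
  drop-∷ zero    (x ∷ xs) _       = x , xs , refl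
  drop-∷ (suc j) (x ∷ xs) (s≤s j<) = drop-∷ j xs j<

  iter-rotate-moves-head : ∀ j x xs {ys} → 0 < j → j < length (x ∷ xs) → Unique (x ∷ xs) →
    iter rotate j (x ∷ xs) ≢ x ∷ ys
  iter-rotate-moves-head (suc j) x xs 0<j (s≤s j<) xs! rotated≡ with drop-∷ j xs j<
  ... | d , ds , drop≡ = Unique-++-disjoint (take (suc j) C) (subst Unique (sym (take++drop≡id (suc j) C)) xs!) (here refl) x∈drop
    where
    C = x ∷ xs
    |take| : length (take (suc j) C) ≡ suc j
    |take| = trans (length-take (suc j) C) (m≤n⇒m⊓n≡m (s≤s (<⇒≤ j<)))
    rotated : iter rotate (suc j) C ≡ drop (suc j) C ++ take (suc j) C
    rotated = trans (cong (iter rotate (suc j)) (sym (take++drop≡id (suc j) C)))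
                    (subst (λ k → iter rotate k (take (suc j) C ++ drop (suc j) C) ≡ drop (suc j) C ++ take (suc j) C) |take|
                           (iter-rotate-++ (take (suc j) C) (drop (suc j) C)))
    x∈drop : x ∈ drop (suc j) C
    x∈drop = subst (x ∈_) (sym drop≡) (here (sym (∷-injectiveˡ
      (trans (sym (cong (_++ take (suc j) C) drop≡)) (trans (sym rotated) rotated≡)))))

  -- The same cycle, traversed backwards from its second vertex.
  reverseFromSecond : List A → List A
  reverseFromSecond (a ∷ b ∷ rest) = b ∷ a ∷ reverse rest
  reverseFromSecond xs             = xs

  reverseFromSecond-involutive : ∀ xs → reverseFromSecond (reverseFromSecond xs) ≡ xs
  reverseFromSecond-involutive []             = refl
  reverseFromSecond-involutive (a ∷ [])       = refl
  reverseFromSecond-involutive (a ∷ b ∷ rest) = cong (λ r → a ∷ b ∷ r) (reverse-involutive rest)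

  reverseFromSecond-↭ : ∀ xs → reverseFromSecond xs ↭ xs
  reverseFromSecond-↭ []             = ↭-refl
  reverseFromSecond-↭ (a ∷ [])       = ↭-refl
  reverseFromSecond-↭ (a ∷ b ∷ rest) = swap b a (↭-reverse rest)

  reverse-reverseFromSecond : ∀ a b rest → reverse (reverseFromSecond (a ∷ b ∷ rest)) ≡ rotate (rotate (a ∷ b ∷ rest))
  reverse-reverseFromSecond a b rest = begin
    reverse (b ∷ a ∷ reverse rest)           ≡⟨ unfold-reverse b (a ∷ reverse rest) ⟩
    reverse (a ∷ reverse rest) ∷ʳ b          ≡⟨ cong (_∷ʳ b) (unfold-reverse a (reverse rest)) ⟩
    (reverse (reverse rest) ∷ʳ a) ∷ʳ b       ≡⟨ cong (λ r → (r ∷ʳ a) ∷ʳ b) (reverse-involutive rest) ⟩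
    (rest ∷ʳ a) ∷ʳ b                         ∎
    where open ≡-Reasoning

  -- With e the head of xs, Chain R e xs says that xs is a closed R-walk.
  module _ (R : A → A → Set) where

    Chain : A → List A → Set
    Chain e []           = ⊤
    Chain e (x ∷ [])     = R x e
    Chain e (x ∷ y ∷ ys) = R x y × Chain e (y ∷ ys)

    Chain-++⁻ : ∀ {e} xs y ys → Chain e (xs ++ y ∷ ys) → Chain y xs × Chain e (y ∷ ys)
    Chain-++⁻ []           y ys c       = tt , c
    Chain-++⁻ (x ∷ [])     y ys (r , c) = r , c
    Chain-++⁻ (x ∷ x′ ∷ xs) y ys (r , c) = Product.map₁ (r ,_) (Chain-++⁻ (x′ ∷ xs) y ys c)

    Chain-++⁺ : ∀ {e} xs y ys → Chain y xs → Chain e (y ∷ ys) → Chain e (xs ++ y ∷ ys)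
    Chain-++⁺ []            y ys _       c  = c
    Chain-++⁺ (x ∷ [])      y ys r       c  = r , c
    Chain-++⁺ (x ∷ x′ ∷ xs) y ys (r , c) c′ = r , Chain-++⁺ (x′ ∷ xs) y ys c c′

    Chain-reverse : (∀ {a b} → R a b → R b a) → ∀ e x xs → Chain e (x ∷ xs) → Chain x (e ∷ reverse xs)
    Chain-reverse R-sym e x []       r       = R-sym r
    Chain-reverse R-sym e x (v ∷ vs) (r , c) = subst (Chain x) (cong (e ∷_) (sym (unfold-reverse v vs)))
      (Chain-++⁺ (e ∷ reverse vs) v [] (Chain-reverse R-sym e v vs c) (R-sym r))

Chain-map : ∀ {A B : Set} {R : A → A → Set} {S : B → B → Set} (f : A → B) →
  (∀ {a b} → R a b → S (f a) (f b)) → ∀ {e} xs → Chain R e xs → Chain S (f e) (map f xs)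
Chain-map f hom []           _       = tt
Chain-map f hom (x ∷ [])     r       = hom r
Chain-map f hom (x ∷ y ∷ ys) (r , c) = hom r , Chain-map f hom (y ∷ ys) c

Chain-mono : ∀ {A : Set} {R S : A → A → Set} → (∀ {a b} → R a b → S a b) → ∀ {e} xs → Chain R e xs → Chain S e xs
Chain-mono R⇒S []           _       = tt
Chain-mono R⇒S (x ∷ [])     r       = R⇒S r
Chain-mono R⇒S (x ∷ y ∷ ys) (r , c) = R⇒S r , Chain-mono R⇒S (y ∷ ys) c

Unique-map-on : ∀ {A B : Set} (f : A → B) {xs : List A} → (∀ {a b} → a ∈ xs → b ∈ xs → f a ≡ f b → a ≡ b) →
  Unique xs → Unique (map f xs)
Unique-map-on f {[]}     _   _          = []
Unique-map-on f {x ∷ xs} inj (x∉ ∷ xs!) =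
  All.map⁺ (All.tabulate λ {y} y∈ fx≡fy → All.lookup x∉ y∈ (inj (here refl) (there y∈) fx≡fy)) ∷
  Unique-map-on f (λ a∈ b∈ → inj (there a∈) (there b∈)) xs!

map-inverse : ∀ {A B : Set} {f : A → B} {g : B → A} → (∀ x → g (f x) ≡ x) → ∀ xs → map g (map f xs) ≡ xs
map-inverse inv xs = trans (sym (map-∘ xs)) (trans (map-cong inv xs) (map-id xs))

map-reverseFromSecond : ∀ {A B : Set} (f : A → B) xs → map f (reverseFromSecond xs) ≡ reverseFromSecond (map f xs)
map-reverseFromSecond f []             = refl
map-reverseFromSecond f (a ∷ [])       = refl
map-reverseFromSecond f (a ∷ b ∷ rest) = cong (λ r → f b ∷ f a ∷ r) (reverse-map f rest)

module _ {A : Set} (f : A → ℕ) where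

  Split-1-1-2 : List A → Set
  Split-1-1-2 xs = Σ A λ p → Σ A λ o₁ → Σ A λ o₂ → (xs ↭ p ∷ o₁ ∷ o₂ ∷ []) × f p ≡ 2 × f o₁ ≡ 1 × f o₂ ≡ 1

  split-1-1-2 : ∀ {a b c} → map f (a ∷ b ∷ c ∷ []) ↭ 1 ∷ 1 ∷ 2 ∷ [] → Split-1-1-2 (a ∷ b ∷ c ∷ [])
  split-1-1-2 {a} {b} {c} π = go (value (here refl)) (value (there (here refl))) (value (there (there (here refl))))
                                 (sum-↭ π) refl refl refl
    where
    value : ∀ {e} → e ∈ map f (a ∷ b ∷ c ∷ []) → e ≡ 1 ⊎ e ≡ 2
    value e∈ with ∈-resp-↭ π e∈
    ... | here refl                 = inj₁ refl
    ... | there (here refl)         = inj₁ refl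
    ... | there (there (here refl)) = inj₂ refl
    go : ∀ {x y z} → x ≡ 1 ⊎ x ≡ 2 → y ≡ 1 ⊎ y ≡ 2 → z ≡ 1 ⊎ z ≡ 2 → x + (y + (z + 0)) ≡ 4 →
         f a ≡ x → f b ≡ y → f c ≡ z → Split-1-1-2 (a ∷ b ∷ c ∷ [])
    go (inj₂ refl) (inj₁ refl) (inj₁ refl) _ fa fb fc = a , b , c , ↭-refl , fa , fb , fc
    go (inj₁ refl) (inj₂ refl) (inj₁ refl) _ fa fb fc = b , a , c , swap a b ↭-refl , fb , fa , fc
    go (inj₁ refl) (inj₁ refl) (inj₂ refl) _ fa fb fc =
      c , a , b , ↭-trans (prep a (swap b c ↭-refl)) (swap a c ↭-refl) , fc , fa , fb
    go (inj₁ refl) (inj₁ refl) (inj₁ refl) ()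
    go (inj₁ refl) (inj₂ refl) (inj₂ refl) ()
    go (inj₂ refl) (inj₁ refl) (inj₂ refl) ()
    go (inj₂ refl) (inj₂ refl) (inj₁ refl) ()
    go (inj₂ refl) (inj₂ refl) (inj₂ refl) ()

singleton-∈ : ∀ {A : Set} {xs : List A} {x y} → length xs ≡ 1 → x ∈ xs → y ∈ xs → x ≡ y
singleton-∈ {xs = _ ∷ []} _ (here refl) (here refl) = refl

nonEmpty-∈ : ∀ {A : Set} {xs : List A} → 1 ≤ length xs → Σ A (_∈ xs)
nonEmpty-∈ {xs = x ∷ _} _ = x , here refl

length-filter+filter-¬ : ∀ {A : Set} {Q : A → Set} (Q? : ∀ x → Dec (Q x)) xs →
  length xs ≡ length (filter Q? xs) + length (filter (¬? ∘ Q?) xs)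
length-filter+filter-¬ Q? [] = refl
length-filter+filter-¬ Q? (x ∷ xs) with Q? x
... | yes _ = cong suc (length-filter+filter-¬ Q? xs)
... | no  _ = trans (cong suc (length-filter+filter-¬ Q? xs)) (sym (+-suc _ _))

module _ {N : ℕ} {R : Fin N → Fin N → Set} (R? : Decidable R) (R-equiv : IsEquivalence R) where

  open IsEquivalence R-equiv renaming (refl to R-refl; sym to R-sym; trans to R-trans)

  class : Fin N → List (Fin N)
  class x = filter (R? x) (allFin N)

  ∈-class⁺ : ∀ {x y} → R x y → y ∈ class x
  ∈-class⁺ {x} r = ∈-filter⁺ (R? x) (∈-allFin _) r

  ∈-class⁻ : ∀ {x y} → y ∈ class x → R x y
  ∈-class⁻ {x} y∈ = proj₂ (∈-filter⁻ (R? x) {xs = allFin N} y∈)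

  uniformClasses⇒∣ : ∀ {k} → (∀ x → length (class x) ≡ k) → k ∣ N
  uniformClasses⇒∣ {k} size =
    subst (k ∣_) (length-tabulate id) (closed-∣ _ (allFin N) ≤-refl (Unique.allFin⁺ N) (λ _ _ → ∈-allFin _))
    where
    closed-∣ : ∀ b S → length S ≤ b → Unique S → (∀ {y z} → y ∈ S → R y z → z ∈ S) → k ∣ length S
    closed-∣ _       []       _          _  _      = k ∣0
    closed-∣ (suc b) (x ∷ S₀) (s≤s |S₀|≤b) S! closed =
      subst (k ∣_) (sym (length-filter+filter-¬ (R? x) S)) (∣m∣n⇒∣m+n (subst (k ∣_) (sym |inside|) ∣-refl)
        (closed-∣ b outside |outside|≤b (Unique.filter⁺ (¬? ∘ R? x) S!) closed-outside))
      where
      S = x ∷ S₀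
      outside = filter (¬? ∘ R? x) S
      |inside| : length (filter (R? x) S) ≡ k
      |inside| = trans (Unique-sameElements⇒length≡ (Unique.filter⁺ (R? x) S!) (Unique.filter⁺ (R? x) (Unique.allFin⁺ N))
        (λ z∈ → ∈-class⁺ (proj₂ (∈-filter⁻ (R? x) {xs = S} z∈)))
        (λ z∈ → ∈-filter⁺ (R? x) (closed (here refl) (∈-class⁻ z∈)) (∈-class⁻ z∈))) (size x)
      |outside|≤b : length outside ≤ b
      |outside|≤b with R? x x
      ... | yes _ = ≤-trans (length-filter (¬? ∘ R? x) S₀) |S₀|≤b
      ... | no ¬r = contradiction R-refl ¬r
      closed-outside : ∀ {y z} → y ∈ outside → R y z → z ∈ outside
      closed-outside y∈ ryz with ∈-filter⁻ (¬? ∘ R? x) {xs = S} y∈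
      ... | y∈S , ¬rxy = ∈-filter⁺ (¬? ∘ R? x) (closed y∈S ryz) (λ rxz → ¬rxy (R-trans rxz (R-sym ryz)))

-- Cycles in a simple graph

module GraphCycles {n : ℕ} (Γ : Graph n) where

  open import Data.List.Membership.DecPropositional (_≟_ {n}) using (_∈?_)

  V : Set
  V = Fin n

  Adj : V → V → Set
  Adj u v = adj Γ u v ≡ true

  Adj-sym : ∀ {u v} → Adj u v → Adj v u
  Adj-sym {u} {v} a = trans (Graph.sym Γ v u) a

  Adj-irrefl : ∀ {u v} → Adj u v → u ≢ v
  Adj-irrefl {u} a refl with () ← trans (sym a) (irrefl Γ u)

  Cycle : List V → Set
  Cycle []       = ⊥
  Cycle (x ∷ xs) = 3 ≤ length (x ∷ xs) × Unique (x ∷ xs) × Chain Adj x (x ∷ xs)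

  notIn⇒All≢ : ∀ x xs → notIn Γ x xs ≡ true → All (x ≢_) xs
  notIn⇒All≢ x []       _ = []
  notIn⇒All≢ x (y ∷ ys) e with x ≟ y
  notIn⇒All≢ x (y ∷ ys) () | yes _
  ... | no x≢y = x≢y ∷ notIn⇒All≢ x ys e

  All≢⇒notIn : ∀ x xs → All (x ≢_) xs → notIn Γ x xs ≡ true
  All≢⇒notIn x []       _          = refl
  All≢⇒notIn x (y ∷ ys) (x≢y ∷ x∉) with x ≟ y
  ... | yes x≡y = contradiction x≡y x≢y
  ... | no  _   = All≢⇒notIn x ys x∉

  allDistinct⇒Unique : ∀ xs → allDistinct Γ xs ≡ true → Unique xs
  allDistinct⇒Unique []       _ = []
  allDistinct⇒Unique (x ∷ xs) e =
    notIn⇒All≢ x xs (∧-conicalˡ _ _ e) ∷ allDistinct⇒Unique xs (∧-conicalʳ _ _ e)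

  Unique⇒allDistinct : ∀ xs → Unique xs → allDistinct Γ xs ≡ true
  Unique⇒allDistinct []       _          = refl
  Unique⇒allDistinct (x ∷ xs) (x∉ ∷ xs!) = cong₂ _∧_ (All≢⇒notIn x xs x∉) (Unique⇒allDistinct xs xs!)

  pathTo⇒Chain : ∀ e xs → pathTo Γ e xs ≡ true → Chain Adj e xs
  pathTo⇒Chain e []           _ = tt
  pathTo⇒Chain e (x ∷ [])     p = p
  pathTo⇒Chain e (x ∷ y ∷ ys) p = ∧-conicalˡ _ _ p , pathTo⇒Chain e (y ∷ ys) (∧-conicalʳ _ _ p)

  Chain⇒pathTo : ∀ e xs → Chain Adj e xs → pathTo Γ e xs ≡ true
  Chain⇒pathTo e []           _       = refl
  Chain⇒pathTo e (x ∷ [])     a       = a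
  Chain⇒pathTo e (x ∷ y ∷ ys) (a , c) = cong₂ _∧_ a (Chain⇒pathTo e (y ∷ ys) c)

  isCycle⇒Cycle : ∀ xs → isCycle Γ xs ≡ true → Cycle xs
  isCycle⇒Cycle (x ∷ xs) e =
    ≤ᵇ⇒≤ 3 _ (Equivalence.from T-≡ (∧-conicalˡ long? _ e)) ,
    allDistinct⇒Unique (x ∷ xs) (∧-conicalˡ distinct? _ rest) ,
    pathTo⇒Chain x (x ∷ xs) (∧-conicalʳ distinct? _ rest)
    where
    long? = 3 ≤ᵇ length (x ∷ xs)
    distinct? = allDistinct Γ (x ∷ xs)
    rest = ∧-conicalʳ long? (distinct? ∧ pathTo Γ x (x ∷ xs)) e

  Cycle⇒isCycle : ∀ xs → Cycle xs → isCycle Γ xs ≡ true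
  Cycle⇒isCycle (x ∷ xs) (3≤ , xs! , c) =
    cong₂ _∧_ (Equivalence.to T-≡ (≤⇒≤ᵇ 3≤))
              (cong₂ _∧_ (Unique⇒allDistinct (x ∷ xs) xs!) (Chain⇒pathTo x (x ∷ xs) c))

  Cycle-rotate : ∀ a b ys → Cycle (a ∷ b ∷ ys) → Cycle (b ∷ ys ∷ʳ a)
  Cycle-rotate a b ys (3≤ , xs! , ab , c) =
    subst (3 ≤_) (↭-length π) 3≤ , Unique-resp-↭ π xs! , Chain-++⁺ Adj (b ∷ ys) a [] c ab
    where π = ∷↭∷ʳ a (b ∷ ys)

  Cycle-rotate⁻ : ∀ a b ys → Cycle (b ∷ ys ∷ʳ a) → Cycle (a ∷ b ∷ ys)
  Cycle-rotate⁻ a b ys (3≤ , xs! , c) =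
    subst (3 ≤_) (↭-length π) 3≤ , Unique-resp-↭ π xs! , Product.swap (Chain-++⁻ Adj (b ∷ ys) a [] c)
    where π = ↭-sym (∷↭∷ʳ a (b ∷ ys))

  Cycle-reverseTail : ∀ x xs → Cycle (x ∷ xs) → Cycle (x ∷ reverse xs)
  Cycle-reverseTail x xs (3≤ , xs! , c) =
    subst (3 ≤_) (↭-length π) 3≤ , Unique-resp-↭ π xs! , Chain-reverse Adj Adj-sym x x xs c
    where π = prep x (↭-sym (↭-reverse xs))

  seqs-complete : ∀ k (w : List V) → length w ≡ k → w ∈ seqs Γ k
  seqs-complete zero    []      _ = here refl
  seqs-complete (suc k) (a ∷ w) e =
    ∈-concat⁺′ (∈-map⁺ (a ∷_) (seqs-complete k w (suc-injective e)))
               (∈-map⁺ (λ a → map (a ∷_) (seqs Γ k)) (∈-allFin a))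

  seqs-length : ∀ k {w : List V} → w ∈ seqs Γ k → length w ≡ k
  seqs-length zero    (here refl) = refl
  seqs-length (suc k) w∈ with ∈-concat⁻′ (map (λ a → map (a ∷_) (seqs Γ k)) (allFin n)) w∈
  ... | ws , w∈ws , ws∈ with ∈-map⁻ (λ a → map (a ∷_) (seqs Γ k)) ws∈
  ... | a , _ , refl with ∈-map⁻ (a ∷_) w∈ws
  ... | w′ , w′∈ , refl = cong suc (seqs-length k w′∈)

  module _ {E : V → V → Set} (E⇒Adj : ∀ {u v} → E u v → Adj u v) (w : ℕ → V)
           (step : ∀ k → E (w k) (w (suc k))) (noBacktrack : ∀ k → w (suc (suc k)) ≢ w k) where

    segment : ℕ → ℕ → List V
    segment i zero    = []
    segment i (suc d) = w i ∷ segment (suc i) d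

    segment-∷ʳ : ∀ i d → segment i (suc d) ≡ segment i d ∷ʳ w (i + d)
    segment-∷ʳ i zero    = cong (λ k → w k ∷ []) (sym (+-identityʳ i))
    segment-∷ʳ i (suc d) =
      cong (w i ∷_) (trans (segment-∷ʳ (suc i) d) (cong (λ k → segment (suc i) d ∷ʳ w k) (sym (+-suc i d))))

    segment-++ : ∀ i d e → segment i (d + e) ≡ segment i d ++ segment (i + d) e
    segment-++ i zero    e = cong (λ k → segment k e) (sym (+-identityʳ i))
    segment-++ i (suc d) e =
      cong (w i ∷_) (trans (segment-++ (suc i) d e) (cong (λ k → segment (suc i) d ++ segment k e) (sym (+-suc i d))))

    ∈-segment⁻ : ∀ {v} i d → v ∈ segment i d → Σ ℕ λ k → k < d × v ≡ w (i + k)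
    ∈-segment⁻ i (suc d) (here refl) = 0 , s≤s z≤n , cong w (sym (+-identityʳ i))
    ∈-segment⁻ i (suc d) (there v∈) with ∈-segment⁻ (suc i) d v∈
    ... | k , k<d , refl = suc k , s≤s k<d , cong w (sym (+-suc i k))

    segment-Chain : ∀ i d → Chain E (w (i + suc d)) (segment i (suc d))
    segment-Chain i zero    = subst (E (w i) ∘ w) (sym (+-comm i 1)) (step i)
    segment-Chain i (suc d) =
      step i , subst (λ k → Chain E (w k) (segment (suc i) (suc d))) (sym (+-suc i (suc d))) (segment-Chain (suc i) d)

    Unique-segment : ∀ j → (∀ k → k < j → w k ∉ segment 0 k) → Unique (segment 0 j)
    Unique-segment zero    _     = []
    Unique-segment (suc j) fresh = subst Unique (sym (segment-∷ʳ 0 j))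
      (Unique.++⁺ (Unique-segment j (λ k k<j → fresh k (m<n⇒m<1+n k<j))) ([] ∷ [])
                  (λ { (w∈ , here refl) → fresh j (n<1+n j) w∈ }))

    closingSegment⇒cycle : ∀ i d → 0 < d → w (i + d) ≡ w i → Unique (segment i d) →
      Σ V λ x → Σ (List V) λ xs → segment i d ≡ x ∷ xs × Cycle (x ∷ xs) × Chain E x (x ∷ xs)
    closingSegment⇒cycle i 1 _ closes _ = contradiction (sym (trans (cong w (+-comm 1 i)) closes)) (Adj-irrefl (E⇒Adj (step i)))
    closingSegment⇒cycle i 2 _ closes _ = contradiction (trans (cong w (+-comm 2 i)) closes) (noBacktrack i)
    closingSegment⇒cycle i d@(suc d′@(suc (suc _))) _ closes seg! =
      w i , segment (suc i) d′ , refl , (s≤s (s≤s (s≤s z≤n)) , seg! , Chain-mono E⇒Adj (segment i d) chain) , chain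
      where
      chain : Chain E (w i) (segment i d)
      chain = subst (λ v → Chain E v (segment i d)) closes (segment-Chain i d′)

    firstRepeat : ∀ {L} → w L ∈ segment 0 L →
      Σ ℕ λ i → Σ ℕ λ d → 0 < d × d ≤ L × w (i + d) ≡ w i × Unique (segment i d)
    firstRepeat {L} repeats with least {P = λ j → w j ∈ segment 0 j} (λ j → w j ∈? segment 0 j) {L} repeats
    ... | j , j≤L , w∈ , fresh with ∈-segment⁻ 0 j w∈
    ... | i , i<j , wj≡wi = i , j ∸ i , m<n⇒0<n∸m i<j , ≤-trans (m∸n≤m j i) j≤L , closes , seg!
      where
      j≡i+d : j ≡ i + (j ∸ i)
      j≡i+d = sym (m+[n∸m]≡n (<⇒≤ i<j))
      closes : w (i + (j ∸ i)) ≡ w i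
      closes = trans (cong w (sym j≡i+d)) wj≡wi
      seg! : Unique (segment i (j ∸ i))
      seg! = Unique-++⁻ʳ (segment 0 i)
        (subst Unique (trans (cong (segment 0) j≡i+d) (segment-++ 0 i (j ∸ i))) (Unique-segment j fresh))

    closedWalk⇒cycle : ∀ {L} → 0 < L → w L ≡ w 0 →
      Σ V λ x → Σ (List V) λ xs → length (x ∷ xs) ≤ L × Cycle (x ∷ xs) × Chain E x (x ∷ xs)
    closedWalk⇒cycle {suc L} _ closes with firstRepeat {suc L} (here closes)
    ... | i , d , 0<d , d≤L , closes′ , seg! with closingSegment⇒cycle i d 0<d closes′ seg!
    ... | x , xs , seg≡ , cycle , chain =
      x , xs , ≤-trans (≤-reflexive (trans (cong length (sym seg≡)) (length-segment i d))) d≤L , cycle , chain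
      where
      length-segment : ∀ i d → length (segment i d) ≡ d
      length-segment i zero    = refl
      length-segment i (suc d) = cong suc (length-segment (suc i) d)

  module Girth {g : ℕ} (hg : HasGirth Γ g) where

    GirthCycle : List V → Set
    GirthCycle C = length C ≡ g × Cycle C

    girth-minimal : ∀ C → Cycle C → g ≤ length C
    girth-minimal C c = proj₂ hg C (Cycle⇒isCycle C c)

    3≤g : 3 ≤ g
    3≤g with proj₁ hg
    ... | x ∷ xs , len , c = subst (3 ≤_) len (proj₁ (isCycle⇒Cycle (x ∷ xs) c))

    GirthCycle-Unique : ∀ {C} → GirthCycle C → Unique C
    GirthCycle-Unique {_ ∷ _} (_ , _ , C! , _) = C!

    GirthCycle-ends : ∀ {x xs} → GirthCycle (x ∷ xs) → Σ V λ y → Σ (List V) λ mid → Σ V λ z → xs ≡ y ∷ mid ∷ʳ z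
    GirthCycle-ends {xs = y ∷ ys} (_ , s≤s (s≤s 1≤) , _) with initLast ys
    ... | mid ∷ʳ′ z = y , mid , z , refl
    ... | []        with () ← 1≤

    GirthCycle-rotate : ∀ a b ys → GirthCycle (a ∷ b ∷ ys) → GirthCycle (b ∷ ys ∷ʳ a)
    GirthCycle-rotate a b ys (len , c) = trans (sym (↭-length (∷↭∷ʳ a (b ∷ ys)))) len , Cycle-rotate a b ys c

    GirthCycle-rotate⁻ : ∀ a b ys → GirthCycle (b ∷ ys ∷ʳ a) → GirthCycle (a ∷ b ∷ ys)
    GirthCycle-rotate⁻ a b ys (len , c) = trans (↭-length (∷↭∷ʳ a (b ∷ ys))) len , Cycle-rotate⁻ a b ys c

    GirthCycle-reverseTail : ∀ x xs → GirthCycle (x ∷ xs) → GirthCycle (x ∷ reverse xs)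
    GirthCycle-reverseTail x xs (len , c) = trans (cong suc (length-reverse xs)) len , Cycle-reverseTail x xs c

    GirthCycle-reverseFromSecond : ∀ a b rest → GirthCycle (a ∷ b ∷ rest) → GirthCycle (b ∷ a ∷ reverse rest)
    GirthCycle-reverseFromSecond a b rest C = subst (GirthCycle ∘ (b ∷_)) (reverse-++ rest (a ∷ []))
      (GirthCycle-reverseTail b (rest ∷ʳ a) (GirthCycle-rotate a b rest C))

    GirthCycle-second≢last : ∀ {v y} mid {z} → GirthCycle (v ∷ y ∷ mid ∷ʳ z) → y ≢ z
    GirthCycle-second≢last mid C with GirthCycle-Unique C
    ... | _ ∷ yz! = Unique-head≢last mid yz!

    GirthCycle-flip : ∀ v y mid z → GirthCycle (v ∷ y ∷ mid ∷ʳ z) → GirthCycle (v ∷ z ∷ reverse mid ∷ʳ y)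
    GirthCycle-flip v y mid z C =
      subst (GirthCycle ∘ (v ∷_)) (reverse-∷-∷ʳ y mid z) (GirthCycle-reverseTail v (y ∷ mid ∷ʳ z) C)

    GirthCycle-reverseTail-∷ʳ : ∀ u ys w → GirthCycle (u ∷ ys ∷ʳ w) → GirthCycle (u ∷ w ∷ reverse ys)
    GirthCycle-reverseTail-∷ʳ u ys w C =
      subst (GirthCycle ∘ (u ∷_)) (reverse-++ ys (w ∷ [])) (GirthCycle-reverseTail u (ys ∷ʳ w) C)

    GirthCycle-reverse : ∀ u ys w → GirthCycle (u ∷ ys ∷ʳ w) → GirthCycle (w ∷ reverse ys ∷ʳ u)
    GirthCycle-reverse u ys w C = GirthCycle-rotate u w (reverse ys) (GirthCycle-reverseTail-∷ʳ u ys w C)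

    GirthCycle-Adj-first : ∀ {v y rest} → GirthCycle (v ∷ y ∷ rest) → Adj v y
    GirthCycle-Adj-first (_ , _ , _ , vy , _) = vy

    GirthCycle-Adj-last : ∀ {v} ys {z} → GirthCycle (v ∷ ys ∷ʳ z) → Adj v z
    GirthCycle-Adj-last {v} ys {z} (_ , _ , _ , chain) = Adj-sym (proj₂ (Chain-++⁻ Adj (v ∷ ys) z [] chain))

    GirthCycle-noChord : ∀ u p pre w post z → GirthCycle (u ∷ p ∷ pre ++ w ∷ post ∷ʳ z) → ¬ Adj w u
    GirthCycle-noChord u p pre w post z (len , _ , C! , chain) wu = <⇒≱ shorter (girth-minimal C′ cycle′)
      where
      C′ = u ∷ p ∷ pre ∷ʳ w
      C≡ : u ∷ p ∷ pre ++ w ∷ post ∷ʳ z ≡ C′ ++ post ∷ʳ z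
      C≡ = cong (λ l → u ∷ p ∷ l) (sym (++-assoc pre (w ∷ []) (post ∷ʳ z)))
      cycle′ : Cycle C′
      cycle′ = s≤s (s≤s (subst (1 ≤_) (sym (length-++ pre)) (m≤n+m 1 (length pre)))) ,
               Unique-++⁻ˡ C′ (subst Unique C≡ C!) ,
               Chain-++⁺ Adj (u ∷ p ∷ pre) w [] (proj₁ (Chain-++⁻ Adj (u ∷ p ∷ pre) w (post ∷ʳ z) chain)) wu
      shorter : length C′ < g
      shorter = subst (length C′ <_) (trans (sym (length-++ C′)) (trans (cong length (sym C≡)) len))
                      (m<m+n (length C′) (subst (0 <_) (sym (length-++ post)) (m≤n+m 1 (length post))))

    someVertex : V
    someVertex with proj₁ hg
    ... | x ∷ _ , _ = x

    traversals : V → V → List (List V)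
    traversals u v = filterᵇ (λ w → isCycle Γ (u ∷ v ∷ w)) (seqs Γ (g ∸ 2))

    ∈-traversals⁺ : ∀ {u v w} → GirthCycle (u ∷ v ∷ w) → w ∈ traversals u v
    ∈-traversals⁺ {u} {v} {w} (len , c) = ∈-filter⁺ (T? ∘ λ w → isCycle Γ (u ∷ v ∷ w))
      (seqs-complete (g ∸ 2) w (cong (_∸ 2) len)) (Equivalence.from T-≡ (Cycle⇒isCycle _ c))

    ∈-traversals⁻ : ∀ {u v w} → w ∈ traversals u v → GirthCycle (u ∷ v ∷ w)
    ∈-traversals⁻ {u} {v} w∈ with ∈-filter⁻ (T? ∘ λ w → isCycle Γ (u ∷ v ∷ w)) {xs = seqs Γ (g ∸ 2)} w∈
    ... | w∈seqs , t = trans (cong (suc ∘ suc) (seqs-length (g ∸ 2) w∈seqs)) (m+[n∸m]≡n (≤-trans (n≤1+n 2) 3≤g)) ,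
                       isCycle⇒Cycle _ (Equivalence.to T-≡ t)

    ε≡1⇒traversal-unique : ∀ {u v w₁ w₂} → ε Γ g u v ≡ 1 →
      GirthCycle (u ∷ v ∷ w₁) → GirthCycle (u ∷ v ∷ w₂) → w₁ ≡ w₂
    ε≡1⇒traversal-unique ε≡1 C₁ C₂ = singleton-∈ ε≡1 (∈-traversals⁺ C₁) (∈-traversals⁺ C₂)

    1≤ε⇒traversal : ∀ {u v} → 1 ≤ ε Γ g u v → Σ (List V) λ w → GirthCycle (u ∷ v ∷ w)
    1≤ε⇒traversal 1≤ε = Product.map₂ ∈-traversals⁻ (nonEmpty-∈ 1≤ε)

-- Cubic graphs of signature (1,1,2)

module Signature112 {n g : ℕ} (Γ : Graph n) (cubic : Cubic Γ) (hg : HasGirth Γ g) (signature : GirthRegular112 Γ g) where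

  open GraphCycles Γ
  open Girth hg
  open import Data.List.Relation.Binary.Subset.DecPropositional (_≟_ {n}) using (_⊆_; _⊆?_)

  ∈-neighbours⁻ : ∀ {v x} → x ∈ neighbours Γ v → Adj v x
  ∈-neighbours⁻ {v} x∈ = Equivalence.to T-≡ (proj₂ (∈-filter⁻ (T? ∘ adj Γ v) {xs = allFin n} x∈))

  ∈-neighbours⁺ : ∀ {v x} → Adj v x → x ∈ neighbours Γ v
  ∈-neighbours⁺ {v} a = ∈-filter⁺ (T? ∘ adj Γ v) (∈-allFin _) (Equivalence.from T-≡ a)

  record Local (v : V) : Set where
    field
      partner o₁ o₂ : V
      neighbours↭   : neighbours Γ v ↭ partner ∷ o₁ ∷ o₂ ∷ []
      ε-partner     : ε Γ g v partner ≡ 2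
      ε-o₁          : ε Γ g v o₁ ≡ 1
      ε-o₂          : ε Γ g v o₂ ≡ 1

  abstract
    local : ∀ v → Local v
    local v with length≡3⇒ (neighbours Γ v) (cubic v)
    ... | a , b , c , nbrs≡
        with split-1-1-2 (ε Γ g v) (subst (λ l → map (ε Γ g v) l ↭ 1 ∷ 1 ∷ 2 ∷ []) nbrs≡ (signature v))
    ... | p , o₁ , o₂ , π , εp , εo₁ , εo₂ = record
      { partner = p ; o₁ = o₁ ; o₂ = o₂ ; neighbours↭ = subst (_↭ _) (sym nbrs≡) π
      ; ε-partner = εp ; ε-o₁ = εo₁ ; ε-o₂ = εo₂ }

  partner O₁ O₂ : V → V
  partner v = Local.partner (local v)
  O₁ v      = Local.o₁ (local v)
  O₂ v      = Local.o₂ (local v)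

  E₁ : V → V → Set
  E₁ u w = w ≡ O₁ u ⊎ w ≡ O₂ u

  private
    ∈-local : ∀ {u w} → Adj u w → w ∈ partner u ∷ O₁ u ∷ O₂ u ∷ []
    ∈-local a = ∈-resp-↭ (Local.neighbours↭ (local _)) (∈-neighbours⁺ a)

    local⇒Adj : ∀ {u w} → w ∈ partner u ∷ O₁ u ∷ O₂ u ∷ [] → Adj u w
    local⇒Adj w∈ = ∈-neighbours⁻ (∈-resp-↭ (↭-sym (Local.neighbours↭ (local _))) w∈)

    Unique-local : ∀ u → Unique (partner u ∷ O₁ u ∷ O₂ u ∷ [])
    Unique-local u = Unique-resp-↭ (Local.neighbours↭ (local u)) (Unique.filter⁺ (T? ∘ adj Γ u) (Unique.allFin⁺ n))

  Adj-partner : ∀ u → Adj u (partner u)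
  Adj-partner u = local⇒Adj (here refl)

  E₁⇒Adj : ∀ {u w} → E₁ u w → Adj u w
  E₁⇒Adj (inj₁ refl) = local⇒Adj (there (here refl))
  E₁⇒Adj (inj₂ refl) = local⇒Adj (there (there (here refl)))

  ε-E₁ : ∀ {u w} → E₁ u w → ε Γ g u w ≡ 1
  ε-E₁ {u} (inj₁ refl) = Local.ε-o₁ (local u)
  ε-E₁ {u} (inj₂ refl) = Local.ε-o₂ (local u)

  E₁⇒≢partner : ∀ {u w} → E₁ u w → w ≢ partner u
  E₁⇒≢partner {u} E refl with () ← trans (sym (ε-E₁ E)) (Local.ε-partner (local u))

  O₁≢O₂ : ∀ u → O₁ u ≢ O₂ u
  O₁≢O₂ u with Unique-local u
  ... | _ ∷ (O₁≢ ∷ []) ∷ _ = O₁≢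

  Adj⇒partner⊎E₁ : ∀ {u w} → Adj u w → w ≡ partner u ⊎ E₁ u w
  Adj⇒partner⊎E₁ a with ∈-local a
  ... | here w≡                 = inj₁ w≡
  ... | there (here w≡)         = inj₂ (inj₁ w≡)
  ... | there (there (here w≡)) = inj₂ (inj₂ w≡)

  E₁-intro : ∀ {u w} → Adj u w → w ≢ partner u → E₁ u w
  E₁-intro a w≢ = [ (λ w≡ → contradiction w≡ w≢) , id ]′ (Adj⇒partner⊎E₁ a)

  E₁-third : ∀ {v t y z} → E₁ v t → E₁ v y → E₁ v z → y ≢ z → t ≢ y → t ≡ z
  E₁-third (inj₁ refl) (inj₁ refl) _           _   t≢y = contradiction refl t≢y
  E₁-third (inj₂ refl) (inj₂ refl) _           _   t≢y = contradiction refl t≢y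
  E₁-third (inj₁ refl) (inj₂ refl) (inj₁ refl) _   _   = refl
  E₁-third (inj₂ refl) (inj₁ refl) (inj₂ refl) _   _   = refl
  E₁-third (inj₁ refl) (inj₂ refl) (inj₂ refl) y≢z _   = contradiction refl y≢z
  E₁-third (inj₂ refl) (inj₁ refl) (inj₁ refl) y≢z _   = contradiction refl y≢z

  private
    partnerTraversal : ∀ v → Σ V λ t → Σ (List V) λ m → E₁ v t × GirthCycle (v ∷ t ∷ m ∷ʳ partner v)
    partnerTraversal v with 1≤ε⇒traversal {v} {partner v} (subst (1 ≤_) (sym (Local.ε-partner (local v))) (s≤s z≤n))
    ... | s , T with GirthCycle-ends T
    ... | _ , m , t , refl =
      t , reverse m , E₁-intro (GirthCycle-Adj-last (partner v ∷ m) T) t≢ , GirthCycle-flip v (partner v) m t T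
      where
      t≢ : t ≢ partner v
      t≢ t≡ = GirthCycle-second≢last m T (sym t≡)

    closesAtPartner : ∀ {v y mid z m} → E₁ v y →
      GirthCycle (v ∷ y ∷ mid ∷ʳ z) → GirthCycle (v ∷ y ∷ m ∷ʳ partner v) → z ≡ partner v
    closesAtPartner {mid = mid} {m = m} E C T = ∷ʳ-injectiveʳ mid m (ε≡1⇒traversal-unique (ε-E₁ E) C T)

    -- A girth cycle through the partner edge leaves v along some ε₁-edge v t; being the only girth cycle through
    -- v t, it is every girth cycle starting along v t, so no girth cycle uses two ε₁-edges at v.
    E₁E₁-notGirth : ∀ {v y mid z} → E₁ v y → E₁ v z → ¬ GirthCycle (v ∷ y ∷ mid ∷ʳ z)
    E₁E₁-notGirth {v} {y} {mid} {z} Ey Ez C with partnerTraversal v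
    ... | t , m , Et , T with t ≟ y
    ... | yes refl = E₁⇒≢partner Ez (closesAtPartner Ey C T)
    ... | no t≢y with refl ← E₁-third Et Ey Ez (GirthCycle-second≢last mid C) t≢y =
      E₁⇒≢partner Ey (closesAtPartner Ez (GirthCycle-flip v y mid z C) T)

  girthCycle-partner : ∀ {v y mid z} → GirthCycle (v ∷ y ∷ mid ∷ʳ z) → y ≡ partner v ⊎ z ≡ partner v
  girthCycle-partner {v} {y} {mid} {z} C with y ≟ partner v | z ≟ partner v
  ... | yes y≡ | _      = inj₁ y≡
  ... | no _   | yes z≡ = inj₂ z≡
  ... | no y≢  | no z≢  =
    ⊥-elim (E₁E₁-notGirth (E₁-intro (GirthCycle-Adj-first C) y≢) (E₁-intro (GirthCycle-Adj-last (y ∷ mid) C) z≢) C)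

  E₁-traversal : ∀ {u w} → E₁ u w → Σ (List V) λ mid → GirthCycle (u ∷ w ∷ mid ∷ʳ partner u)
  E₁-traversal {u} {w} E with 1≤ε⇒traversal {u} {w} (≤-reflexive (sym (ε-E₁ E)))
  ... | s , T with GirthCycle-ends T
  ... | _ , mid , z , refl with girthCycle-partner T
  ... | inj₁ w≡   = contradiction w≡ (E₁⇒≢partner E)
  ... | inj₂ refl = mid , T

  partner-involutive : ∀ u → partner (partner u) ≡ u
  partner-involutive u with Adj⇒partner⊎E₁ (Adj-sym (Adj-partner u))
  ... | inj₁ u≡ = sym u≡
  ... | inj₂ E  =
    contradiction (∷-injectiveˡ (ε≡1⇒traversal-unique (ε-E₁ E) (through (inj₁ refl)) (through (inj₂ refl)))) (O₁≢O₂ u)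
    where
    through : ∀ {w} (E′ : E₁ u w) → GirthCycle (partner u ∷ u ∷ w ∷ proj₁ (E₁-traversal E′))
    through {w} E′ = GirthCycle-rotate⁻ (partner u) u (w ∷ proj₁ (E₁-traversal E′)) (proj₂ (E₁-traversal E′))

  partner-injective : ∀ {x y} → partner x ≡ partner y → x ≡ y
  partner-injective {x} {y} e = trans (sym (partner-involutive x)) (trans (cong partner e) (partner-involutive y))

  partner-swap : ∀ {x y} → y ≡ partner x → x ≡ partner y
  partner-swap {x} y≡ = trans (sym (partner-involutive x)) (cong partner (sym y≡))

  partner-≢ : ∀ u → partner u ≢ u
  partner-≢ u e = Adj-irrefl (Adj-partner u) (sym e)

  E₁-sym : ∀ {u w} → E₁ u w → E₁ w u
  E₁-sym E = E₁-intro (Adj-sym (E₁⇒Adj E)) (λ u≡ → E₁⇒≢partner E (partner-swap u≡))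

  noTriangle : ∀ {a b c} → ¬ GirthCycle (a ∷ b ∷ c ∷ [])
  noTriangle {a} {b} {c} C with GirthCycle-Unique C
  ... | (a≢b ∷ a≢c ∷ []) ∷ (b≢c ∷ []) ∷ _ =
    matching (girthCycle-partner {mid = []} C) (girthCycle-partner {mid = []} C₂) (girthCycle-partner {mid = []} C₃)
    where
    C₂ = GirthCycle-rotate a b (c ∷ []) C
    C₃ = GirthCycle-rotate b c (a ∷ []) C₂
    matching : b ≡ partner a ⊎ c ≡ partner a → c ≡ partner b ⊎ a ≡ partner b → a ≡ partner c ⊎ b ≡ partner c → ⊥
    matching (inj₁ pa) _         (inj₁ pc) = b≢c (partner-injective (trans (sym (partner-swap pa)) pc))
    matching (inj₁ pa) _         (inj₂ pc) = a≢c (partner-injective (trans (sym pa) pc))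
    matching (inj₂ pa) (inj₁ pb) _         = a≢b (partner-injective (trans (sym pa) pb))
    matching (inj₂ pa) (inj₂ pb) _         = b≢c (partner-injective (trans (sym pb) (partner-swap pa)))

  4≤g : 4 ≤ g
  4≤g with m≤n⇒m<n∨m≡n 3≤g | proj₁ hg
  ... | inj₁ 3<g  | _            = 3<g
  ... | inj₂ refl | C , len , c  = ⊥-elim (triangle C len (isCycle⇒Cycle C c))
    where
    triangle : ∀ C → length C ≡ 3 → ¬ Cycle C
    triangle (a ∷ b ∷ c ∷ []) len cyc = noTriangle (len , cyc)

  E₁-girthCycle : ∀ {u w} → E₁ u w → Σ V λ q → Σ (List V) λ rest → GirthCycle (u ∷ partner u ∷ q ∷ rest ∷ʳ w)
  E₁-girthCycle {u} {w} E with E₁-traversal E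
  ... | mid , T with reverse mid | GirthCycle-flip u w mid (partner u) T
  ... | q ∷ rest | C        = q , rest , C
  ... | []       | len , _  = contradiction (subst (4 ≤_) (sym len) 4≤g) (<⇒≱ (n<1+n 3))

  E₁-girthCycle-unique : ∀ {u w ys ys′} → E₁ u w → GirthCycle (u ∷ ys ∷ʳ w) → GirthCycle (u ∷ ys′ ∷ʳ w) → ys ≡ ys′
  E₁-girthCycle-unique {u} {w} {ys} {ys′} E C C′ = reverse-injective
    (ε≡1⇒traversal-unique (ε-E₁ E) (GirthCycle-reverseTail-∷ʳ u ys w C) (GirthCycle-reverseTail-∷ʳ u ys′ w C′))

  -- A flag is an ordered ε₁-edge (base x, target x), stored as the pair (base x, side x) where side x selects
  -- O₁ or O₂.  The arc of the map carrying x is base x.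
  Flag : Set
  Flag = Fin (n + n)

  abstract
    flag : V → Bool → Flag
    flag u false = join n n (inj₁ u)
    flag u true  = join n n (inj₂ u)

    base : Flag → V
    base x = [ id , id ]′ (splitAt n x)

    side : Flag → Bool
    side x = [ const false , const true ]′ (splitAt n x)

    base-flag : ∀ u b → base (flag u b) ≡ u
    base-flag u false rewrite splitAt-join n n (inj₁ u) = refl
    base-flag u true  rewrite splitAt-join n n (inj₂ u) = refl

    side-flag : ∀ u b → side (flag u b) ≡ b
    side-flag u false rewrite splitAt-join n n (inj₁ u) = refl
    side-flag u true  rewrite splitAt-join n n (inj₂ u) = refl

    flag-η : ∀ x → flag (base x) (side x) ≡ x
    flag-η x with splitAt n x in eq
    ... | inj₁ u = trans (cong (join n n) (sym eq)) (join-splitAt n n x)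
    ... | inj₂ u = trans (cong (join n n) (sym eq)) (join-splitAt n n x)

  flag-≡ : ∀ {x y} → base x ≡ base y → side x ≡ side y → x ≡ y
  flag-≡ {x} {y} b≡ s≡ = trans (sym (flag-η x)) (trans (cong₂ flag b≡ s≡) (flag-η y))

  target : Flag → V
  target x = if side x then O₂ (base x) else O₁ (base x)

  E₁-target : ∀ x → E₁ (base x) (target x)
  E₁-target x with side x
  ... | true  = inj₂ refl
  ... | false = inj₁ refl

  side-target : ∀ x → side x ≡ does (target x ≟ O₂ (base x))
  side-target x with side x
  ... | true  = sym (dec-true (O₂ (base x) ≟ O₂ (base x)) refl)
  ... | false = sym (dec-false (O₁ (base x) ≟ O₂ (base x)) (O₁≢O₂ (base x)))

  flag-ext : ∀ {x y} → base x ≡ base y → target x ≡ target y → x ≡ y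
  flag-ext {x} {y} b≡ t≡ =
    flag-≡ b≡ (trans (side-target x) (trans (cong₂ (λ t u → does (t ≟ O₂ u)) t≡ b≡) (sym (side-target y))))

  abstract
    flagAt : V → V → Flag
    flagAt u w = flag u (does (w ≟ O₂ u))

    base-flagAt : ∀ u w → base (flagAt u w) ≡ u
    base-flagAt u w = base-flag u (does (w ≟ O₂ u))

    target-flagAt : ∀ {u w} → E₁ u w → target (flagAt u w) ≡ w
    target-flagAt {u} {w} E =
      trans (cong₂ (λ b s → if s then O₂ b else O₁ b) (base-flag u d) (side-flag u d)) (pick (w ≟ O₂ u))
      where
      d : Bool
      d = does (w ≟ O₂ u)
      pick : (w≟ : Dec (w ≡ O₂ u)) → (if does w≟ then O₂ u else O₁ u) ≡ w
      pick (yes w≡) = sym w≡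
      pick (no w≢)  = [ sym , (λ w≡ → contradiction w≡ w≢) ]′ E

  r₂ : Flag → Flag
  r₂ x = flag (base x) (not (side x))

  base-r₂ : ∀ x → base (r₂ x) ≡ base x
  base-r₂ x = base-flag (base x) _

  side-r₂ : ∀ x → side (r₂ x) ≡ not (side x)
  side-r₂ x = side-flag (base x) _

  r₂-involutive : ∀ x → r₂ (r₂ x) ≡ x
  r₂-involutive x = flag-≡ (trans (base-r₂ (r₂ x)) (base-r₂ x))
                            (trans (side-r₂ (r₂ x)) (trans (cong not (side-r₂ x)) (not-involutive (side x))))

  r₂-≢ : ∀ x → r₂ x ≢ x
  r₂-≢ x e = not-¬ refl (sym (trans (sym (side-r₂ x)) (cong side e)))

  sameBase : ∀ {x y} → base x ≡ base y → x ≡ y ⊎ x ≡ r₂ y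
  sameBase {x} {y} b≡ with ≡⊎≡not (side x) (side y)
  ... | inj₁ s≡ = inj₁ (flag-≡ b≡ s≡)
  ... | inj₂ s≡ = inj₂ (flag-≡ (trans b≡ (sym (base-r₂ y))) (trans s≡ (sym (side-r₂ y))))

  abstract
    faceThird : Flag → V
    faceThird x = proj₁ (E₁-girthCycle (E₁-target x))

    faceRest : Flag → List V
    faceRest x = proj₁ (proj₂ (E₁-girthCycle (E₁-target x)))

  -- The girth cycle through the ε₁-edge of x, read from base x away from target x.  The face of the map through x
  -- has as its g/2 edges the matching edges of this cycle.
  faceCycle : Flag → List V
  faceCycle x = base x ∷ partner (base x) ∷ faceThird x ∷ faceRest x ∷ʳ target x

  abstract
    faceCycle-girth : ∀ x → GirthCycle (faceCycle x)
    faceCycle-girth x = proj₂ (proj₂ (E₁-girthCycle (E₁-target x)))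

  faceCycle-unique : ∀ {x u w ys} → base x ≡ u → target x ≡ w → GirthCycle (u ∷ ys ∷ʳ w) → faceCycle x ≡ u ∷ ys ∷ʳ w
  faceCycle-unique {x} refl refl C = cong (λ l → base x ∷ l ∷ʳ target x)
    (E₁-girthCycle-unique {ys = partner (base x) ∷ faceThird x ∷ faceRest x} (E₁-target x) (faceCycle-girth x) C)

  faceCycle-injective : ∀ {x y} → faceCycle x ≡ faceCycle y → x ≡ y
  faceCycle-injective {x} {y} e with ∷-injective e
  ... | b≡ , rest≡ =
    flag-ext b≡ (∷ʳ-injectiveʳ (partner (base x) ∷ faceThird x ∷ faceRest x) (partner (base y) ∷ faceThird y ∷ faceRest y) rest≡)

  r₁ : Flag → Flag
  r₁ x = flagAt (target x) (base x)

  base-r₁ : ∀ x → base (r₁ x) ≡ target x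
  base-r₁ x = base-flagAt (target x) (base x)

  target-r₁ : ∀ x → target (r₁ x) ≡ base x
  target-r₁ x = target-flagAt (E₁-sym (E₁-target x))

  faceCycle-r₁ : ∀ x → faceCycle (r₁ x) ≡ reverse (faceCycle x)
  faceCycle-r₁ x = begin
    faceCycle (r₁ x)                         ≡⟨ faceCycle-unique {ys = reverse ys} (base-r₁ x) (target-r₁ x) reversed ⟩
    target x ∷ reverse ys ∷ʳ base x          ≡⟨ sym (reverse-∷-∷ʳ (base x) ys (target x)) ⟩
    reverse (faceCycle x)                    ∎
    where
    open ≡-Reasoning
    ys = partner (base x) ∷ faceThird x ∷ faceRest x
    reversed = GirthCycle-reverse (base x) ys (target x) (faceCycle-girth x)

  r₀ : Flag → Flag
  r₀ x = flagAt (partner (base x)) (faceThird x)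

  base-r₀ : ∀ x → base (r₀ x) ≡ partner (base x)
  base-r₀ x = base-flagAt (partner (base x)) (faceThird x)

  target-r₀ : ∀ x → target (r₀ x) ≡ faceThird x
  target-r₀ x = target-flagAt (E₁-intro (GirthCycle-Adj-first rotated) third≢)
    where
    u = base x
    rotated = GirthCycle-rotate u (partner u) (faceThird x ∷ faceRest x ∷ʳ target x) (faceCycle-girth x)
    third≢ : faceThird x ≢ partner (partner u)
    third≢ e with GirthCycle-Unique (faceCycle-girth x)
    ... | u∉ ∷ _ = All.lookup u∉ (there (here refl)) (trans (sym (partner-involutive u)) (sym e))

  faceCycle-r₀ : ∀ x → faceCycle (r₀ x) ≡ reverseFromSecond (faceCycle x)
  faceCycle-r₀ x = begin
    faceCycle (r₀ x)
      ≡⟨ faceCycle-unique {ys = u ∷ w ∷ reverse rest} (base-r₀ x) (target-r₀ x) backwards ⟩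
    partner u ∷ (u ∷ w ∷ reverse rest) ∷ʳ q
      ≡⟨ cong (λ l → partner u ∷ u ∷ l) (sym (reverse-∷-∷ʳ q rest w)) ⟩
    partner u ∷ u ∷ reverse (q ∷ rest ∷ʳ w)
      ∎
    where
    open ≡-Reasoning
    u = base x
    q = faceThird x
    rest = faceRest x
    w = target x
    backwards : GirthCycle (partner u ∷ (u ∷ w ∷ reverse rest) ∷ʳ q)
    backwards = subst (GirthCycle ∘ λ l → partner u ∷ u ∷ l) (reverse-∷-∷ʳ q rest w)
                      (GirthCycle-reverseFromSecond u (partner u) (q ∷ rest ∷ʳ w) (faceCycle-girth x))

  r₀-involutive : ∀ x → r₀ (r₀ x) ≡ x
  r₀-involutive x = faceCycle-injective (begin
    faceCycle (r₀ (r₀ x))                                ≡⟨ faceCycle-r₀ (r₀ x) ⟩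
    reverseFromSecond (faceCycle (r₀ x))                 ≡⟨ cong reverseFromSecond (faceCycle-r₀ x) ⟩
    reverseFromSecond (reverseFromSecond (faceCycle x))  ≡⟨ reverseFromSecond-involutive (faceCycle x) ⟩
    faceCycle x                                          ∎)
    where open ≡-Reasoning

  r₁-involutive : ∀ x → r₁ (r₁ x) ≡ x
  r₁-involutive x = faceCycle-injective (begin
    faceCycle (r₁ (r₁ x))            ≡⟨ faceCycle-r₁ (r₁ x) ⟩
    reverse (faceCycle (r₁ x))       ≡⟨ cong reverse (faceCycle-r₁ x) ⟩
    reverse (reverse (faceCycle x))  ≡⟨ reverse-involutive (faceCycle x) ⟩
    faceCycle x                      ∎)
    where open ≡-Reasoning

  r₀-≢ : ∀ x → r₀ x ≢ x
  r₀-≢ x e = partner-≢ (base x) (trans (sym (base-r₀ x)) (cong base e))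

  r₁-≢ : ∀ x → r₁ x ≢ x
  r₁-≢ x e = Adj-irrefl (E₁⇒Adj (E₁-target x)) (sym (trans (sym (base-r₁ x)) (cong base e)))

  r₀r₂-≢ : ∀ x → r₀ (r₂ x) ≢ x
  r₀r₂-≢ x e = partner-≢ (base x) (trans (cong partner (sym (base-r₂ x))) (trans (sym (base-r₀ (r₂ x))) (cong base e)))

  r₀r₂-commute : ∀ x → r₀ (r₂ x) ≡ r₂ (r₀ x)
  r₀r₂-commute x
    with sameBase {r₀ (r₂ x)} {r₀ x} (trans (base-r₀ (r₂ x)) (trans (cong partner (base-r₂ x)) (sym (base-r₀ x))))
  ... | inj₂ e = e
  ... | inj₁ e = contradiction (trans (sym (r₀-involutive (r₂ x))) (trans (cong r₀ e) (r₀-involutive x))) (r₂-≢ x)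

  target-r₂-≢ : ∀ x → target (r₂ x) ≢ target x
  target-r₂-≢ x e = r₂-≢ x (flag-ext (base-r₂ x) e)

  target∈faceCycle : ∀ x → target x ∈ faceCycle x
  target∈faceCycle x = there (there (∈-++⁺ʳ (faceThird x ∷ faceRest x) (here refl)))

  SameVertices : Flag → Flag → Set
  SameVertices x y = faceCycle x ⊆ faceCycle y × faceCycle y ⊆ faceCycle x

  SameVertices? : Decidable SameVertices
  SameVertices? x y = (faceCycle x ⊆? faceCycle y) ×-dec (faceCycle y ⊆? faceCycle x)

  SameVertices-isEquivalence : IsEquivalence SameVertices
  SameVertices-isEquivalence = record
    { refl  = id , id
    ; sym   = Product.swap
    ; trans = λ (xy , yx) (yz , zy) → yz ∘ xy , yx ∘ zy
    }

  open IsEquivalence SameVertices-isEquivalence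
    using () renaming (refl to SameVertices-refl; sym to SameVertices-sym; trans to SameVertices-trans)

  ↭⇒SameVertices : ∀ {x y} → faceCycle x ↭ faceCycle y → SameVertices x y
  ↭⇒SameVertices π = ∈-resp-↭ π , ∈-resp-↭ (↭-sym π)

  SameVertices-r₀ : ∀ x → SameVertices x (r₀ x)
  SameVertices-r₀ x =
    ↭⇒SameVertices (↭-sym (subst (_↭ faceCycle x) (sym (faceCycle-r₀ x)) (reverseFromSecond-↭ (faceCycle x))))

  SameVertices-r₁ : ∀ x → SameVertices x (r₁ x)
  SameVertices-r₁ x = ↭⇒SameVertices (↭-sym (subst (_↭ faceCycle x) (sym (faceCycle-r₁ x)) (↭-reverse (faceCycle x))))

  -- The other ε₁-neighbour of base y, target (r₂ y), would be a chord of the girth cycle faceCycle y.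
  r₂-leavesFace : ∀ y → ¬ SameVertices y (r₂ y)
  r₂-leavesFace y (_ , back) = locate (back (target∈faceCycle (r₂ y)))
    where
    u = base y
    w′ = target (r₂ y)
    E′ : E₁ u w′
    E′ = subst (λ v → E₁ v w′) (base-r₂ y) (E₁-target (r₂ y))
    locate : w′ ∉ faceCycle y
    locate (here w′≡u)         = Adj-irrefl (E₁⇒Adj E′) (sym w′≡u)
    locate (there (here w′≡p)) = E₁⇒≢partner E′ w′≡p
    locate (there (there w′∈)) with ∈-++⁻ (faceThird y ∷ faceRest y) w′∈
    ... | inj₂ (here w′≡w) = target-r₂-≢ y w′≡w
    ... | inj₁ w′∈mid with ∈-∃++ w′∈mid
    ... | pre , post , mid≡ = GirthCycle-noChord u (partner u) pre w′ post (target y) chordal (Adj-sym (E₁⇒Adj E′))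
      where
      chordal : GirthCycle (u ∷ partner u ∷ pre ++ w′ ∷ post ∷ʳ target y)
      chordal = subst (λ l → GirthCycle (u ∷ partner u ∷ l))
                      (trans (cong (_∷ʳ target y) mid≡) (++-assoc pre (w′ ∷ post) (target y ∷ [])))
                      (faceCycle-girth y)

  FaceStep⇒SameVertices : ∀ {x y} → Star (FaceStep r₀ r₁) x y → SameVertices x y
  FaceStep⇒SameVertices []           = SameVertices-refl
  FaceStep⇒SameVertices (f₀ ◅ steps) = SameVertices-trans (SameVertices-r₀ _) (FaceStep⇒SameVertices steps)
  FaceStep⇒SameVertices (f₁ ◅ steps) = SameVertices-trans (SameVertices-r₁ _) (FaceStep⇒SameVertices steps)

  private
    reach-sameBase : ∀ {x y} → base x ≡ base y → Star (FlagStep r₀ r₁ r₂) x y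
    reach-sameBase {x} {y} b≡ with sameBase {y} {x} (sym b≡)
    ... | inj₁ refl = []
    ... | inj₂ refl = s₂ ◅ []

    reach-neighbour : ∀ {x u′} → Adj (base x) u′ → Σ Flag λ y → base y ≡ u′ × Star (FlagStep r₀ r₁ r₂) x y
    reach-neighbour {x} {u′} a with Adj⇒partner⊎E₁ a
    ... | inj₁ refl = r₀ x , base-r₀ x , s₀ ◅ []
    ... | inj₂ E    =
      r₁ z , trans (base-r₁ z) (target-flagAt E) , reach-sameBase (sym (base-flagAt (base x) u′)) ◅◅ (s₁ ◅ [])
      where z = flagAt (base x) u′

    reach : ∀ {u v} → Star (Edge Γ) u v → ∀ x y → base x ≡ u → base y ≡ v → Star (FlagStep r₀ r₁ r₂) x y
    reach []               x y refl y≡ = reach-sameBase (sym y≡)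
    reach (edge a ◅ path) x y refl y≡ with reach-neighbour a
    ... | z , z≡ , x→z = x→z ◅◅ reach path z y z≡ y≡

  flagMap : Connected Γ → Map (n + n)
  flagMap connected = record
    { r₀ = r₀ ; r₁ = r₁ ; r₂ = r₂
    ; inv₀ = r₀-involutive ; inv₁ = r₁-involutive ; inv₂ = r₂-involutive
    ; fpf₀ = r₀-≢ ; fpf₁ = r₁-≢ ; fpf₂ = r₂-≢
    ; comm₀₂ = r₀r₂-commute ; fpf₀₂ = r₀r₂-≢
    ; connected = λ x y → reach (connected (base x) (base y)) x y refl refl
    ; simpleFace = λ x steps → r₂-leavesFace x (FaceStep⇒SameVertices steps)
    }

  -- Faces

  ρ : Flag → Flag
  ρ x = r₁ (r₀ x)

  faceCycle-ρ : ∀ x → faceCycle (ρ x) ≡ rotate (rotate (faceCycle x))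
  faceCycle-ρ x = begin
    faceCycle (r₁ (r₀ x))                      ≡⟨ faceCycle-r₁ (r₀ x) ⟩
    reverse (faceCycle (r₀ x))                 ≡⟨ cong reverse (faceCycle-r₀ x) ⟩
    reverse (reverseFromSecond (faceCycle x))  ≡⟨ reverse-reverseFromSecond (base x) (partner (base x)) rest ⟩
    rotate (rotate (faceCycle x))              ∎
    where
    open ≡-Reasoning
    rest = faceThird x ∷ faceRest x ∷ʳ target x

  faceCycle-iter-ρ : ∀ k x → faceCycle (iter ρ k x) ≡ iter rotate (double k) (faceCycle x)
  faceCycle-iter-ρ zero    x = refl
  faceCycle-iter-ρ (suc k) x = trans (faceCycle-ρ (iter ρ k x)) (cong (rotate ∘ rotate) (faceCycle-iter-ρ k x))

  -- Rotating a face of odd length g by g - 1 places brings its last edge w u to the front, making u the partner of w.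
  girth-not-odd : Flag → ∀ m → g ≢ suc (double m)
  girth-not-odd x m g≡ = E₁⇒≢partner (E₁-target x) (partner-swap (sym (trans (cong partner (sym base≡)) partner≡)))
    where
    pre = base x ∷ partner (base x) ∷ faceThird x ∷ faceRest x
    |pre| : length pre ≡ double m
    |pre| = suc-injective (trans (trans (+-comm 1 (length pre)) (sym (length-++ pre)))
                                 (trans (proj₁ (faceCycle-girth x)) g≡))
    rotated : faceCycle (iter ρ m x) ≡ target x ∷ pre
    rotated = begin
      faceCycle (iter ρ m x)                      ≡⟨ faceCycle-iter-ρ m x ⟩
      iter rotate (double m) (faceCycle x)        ≡⟨ cong (λ k → iter rotate k (faceCycle x)) (sym |pre|) ⟩
      iter rotate (length pre) (pre ∷ʳ target x)  ≡⟨ iter-rotate-++ pre (target x ∷ []) ⟩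
      target x ∷ pre                              ∎
      where open ≡-Reasoning
    base≡ : base (iter ρ m x) ≡ target x
    base≡ = ∷-injectiveˡ rotated
    partner≡ : partner (base (iter ρ m x)) ≡ base x
    partner≡ = ∷-injectiveˡ (∷-injectiveʳ rotated)

  girth-even : Σ ℕ λ h → g ≡ double h
  girth-even with even⊎odd g
  ... | h , inj₁ g≡ = h , g≡
  ... | m , inj₂ g≡ = contradiction g≡ (girth-not-odd (flag someVertex false) m)

  facePeriod : ∀ {h} → g ≡ double h → ∀ x → IsPeriod ρ x h
  facePeriod {h} g≡ x = positive h g≡ , back , moves
    where
    C = faceCycle x
    |C| : length C ≡ double h
    |C| = trans (proj₁ (faceCycle-girth x)) g≡
    positive : ∀ h → g ≡ double h → 0 < h
    positive (suc _) _   = s≤s z≤n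
    positive zero    g≡0 = contradiction (subst (3 ≤_) g≡0 3≤g) λ ()
    back : iter ρ h x ≡ x
    back = faceCycle-injective (begin
      faceCycle (iter ρ h x)              ≡⟨ faceCycle-iter-ρ h x ⟩
      iter rotate (double h) C            ≡⟨ cong (λ k → iter rotate k C) (sym |C|) ⟩
      iter rotate (length C) C            ≡⟨ iter-rotate-length C ⟩
      C                                   ∎)
      where open ≡-Reasoning
    moves : ∀ k → 0 < k → k < h → iter ρ k x ≢ x
    moves k@(suc _) _ k<h back′ =
      iter-rotate-moves-head (double k) (base x) (partner (base x) ∷ faceThird x ∷ faceRest x ∷ʳ target x)
        (s≤s z≤n) (subst (double k <_) (sym |C|) (double-mono-< k<h)) (GirthCycle-Unique (faceCycle-girth x))
        (trans (sym (faceCycle-iter-ρ k x)) (cong faceCycle back′))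

  faceFlag : Flag → ℕ → Flag
  faceFlag x zero          = x
  faceFlag x (suc zero)    = r₀ x
  faceFlag x (suc (suc j)) = faceFlag (ρ x) j

  faceFlag-head : ∀ j x → Σ (List V) λ ys → iter rotate j (faceCycle x) ≡ base (faceFlag x j) ∷ ys
  faceFlag-head zero          x = _ , refl
  faceFlag-head (suc zero)    x = ys , cong (_∷ ys) (sym (base-r₀ x))
    where ys = (faceThird x ∷ faceRest x ∷ʳ target x) ∷ʳ base x
  faceFlag-head (suc (suc j)) x with faceFlag-head j (ρ x)
  ... | ys , e = ys , (begin
    iter rotate (suc (suc j)) C          ≡⟨ iter-suc rotate (suc j) C ⟩
    iter rotate (suc j) (rotate C)       ≡⟨ iter-suc rotate j (rotate C) ⟩
    iter rotate j (rotate (rotate C))    ≡⟨ cong (iter rotate j) (sym (faceCycle-ρ x)) ⟩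
    iter rotate j (faceCycle (ρ x))      ≡⟨ e ⟩
    base (faceFlag (ρ x) j) ∷ ys         ∎)
    where
    open ≡-Reasoning
    C = faceCycle x

  SameVertices-faceFlag : ∀ j x → SameVertices x (faceFlag x j)
  SameVertices-faceFlag zero          x = SameVertices-refl
  SameVertices-faceFlag (suc zero)    x = SameVertices-r₀ x
  SameVertices-faceFlag (suc (suc j)) x =
    SameVertices-trans (SameVertices-trans (SameVertices-r₀ x) (SameVertices-r₁ (r₀ x))) (SameVertices-faceFlag j (ρ x))

  ∈faceCycle⇒base-faceFlag : ∀ x {v} → v ∈ faceCycle x → Σ ℕ λ j → base (faceFlag x j) ≡ v
  ∈faceCycle⇒base-faceFlag x {v} v∈ with ∈-∃++ v∈
  ... | pre , post , C≡ with faceFlag-head (length pre) x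
  ... | ys , e = length pre , ∷-injectiveˡ (trans (sym e) rotated)
    where
    rotated : iter rotate (length pre) (faceCycle x) ≡ v ∷ post ++ pre
    rotated = trans (cong (iter rotate (length pre)) C≡) (iter-rotate-++ pre (v ∷ post))

  faceClass : Flag → List Flag
  faceClass = class SameVertices? SameVertices-isEquivalence

  length-faceClass : ∀ x → length (faceClass x) ≡ g
  length-faceClass x = begin
    length (faceClass x)
      ≡⟨ sym (length-map base (faceClass x)) ⟩
    length (map base (faceClass x))
      ≡⟨ Unique-sameElements⇒length≡ bases! (GirthCycle-Unique (faceCycle-girth x)) ⊆face face⊆ ⟩
    length (faceCycle x)
      ≡⟨ proj₁ (faceCycle-girth x) ⟩
    g ∎
    where
    open ≡-Reasoning
    ∈-class⁻′ = ∈-class⁻ SameVertices? SameVertices-isEquivalence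
    base-injective : ∀ {a b} → a ∈ faceClass x → b ∈ faceClass x → base a ≡ base b → a ≡ b
    base-injective {a} {b} a∈ b∈ e with sameBase e
    ... | inj₁ a≡b  = a≡b
    ... | inj₂ a≡r₂b = ⊥-elim (r₂-leavesFace b
      (subst (SameVertices b) a≡r₂b (SameVertices-trans (SameVertices-sym (∈-class⁻′ b∈)) (∈-class⁻′ a∈))))
    bases! : Unique (map base (faceClass x))
    bases! = Unique-map-on base base-injective (Unique.filter⁺ (SameVertices? x) (Unique.allFin⁺ (n + n)))
    ⊆face : ∀ {v} → v ∈ map base (faceClass x) → v ∈ faceCycle x
    ⊆face v∈ with ∈-map⁻ base v∈
    ... | y , y∈ , refl = proj₂ (∈-class⁻′ y∈) (here refl)
    face⊆ : ∀ {v} → v ∈ faceCycle x → v ∈ map base (faceClass x)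
    face⊆ v∈ with ∈faceCycle⇒base-faceFlag x v∈
    ... | j , refl = ∈-map⁺ base (∈-class⁺ SameVertices? SameVertices-isEquivalence (SameVertices-faceFlag j x))

  half-girth∣n : ∀ {h} → g ≡ double h → h ∣ n
  half-girth∣n {h} g≡ = *-cancelˡ-∣ 2 (subst₂ _∣_ g≡2*h (cong (n +_) (sym (+-identityʳ n))) g∣n+n)
    where
    g≡2*h : g ≡ 2 * h
    g≡2*h = trans g≡ (trans (double≡*2 h) (*-comm h 2))
    g∣n+n : g ∣ n + n
    g∣n+n = uniformClasses⇒∣ SameVertices? SameVertices-isEquivalence length-faceClass

  -- Truncation and arc-transitivity

  SameArc⇒base≡ : ∀ {x y} → y ≡ x ⊎ y ≡ r₂ x → base x ≡ base y
  SameArc⇒base≡     (inj₁ refl) = refl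
  SameArc⇒base≡ {x} (inj₂ refl) = sym (base-r₂ x)

  base≡⇒SameArc : ∀ {x y} → base x ≡ base y → y ≡ x ⊎ y ≡ r₂ x
  base≡⇒SameArc e = sameBase (sym e)

  truncation : (connected : Connected Γ) → TrIso Γ (flagMap connected)
  truncation connected =
    base , (λ v → flag v false , base-flag v false) , (λ x y → base≡⇒SameArc , SameArc⇒base≡) ,
    λ x y → Adj⇒TrAdj , TrAdj⇒Adj
    where
    M = flagMap connected
    Adj⇒TrAdj : ∀ {x y} → Adj (base x) (base y) → TrAdj M x y
    Adj⇒TrAdj {x} {y} a with Adj⇒partner⊎E₁ a
    ... | inj₁ y≡ = (λ s → Adj-irrefl a (SameArc⇒base≡ s)) , x , r₀ x , inj₁ refl ,
                    base≡⇒SameArc (trans y≡ (sym (base-r₀ x))) , inj₁ refl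
    ... | inj₂ E  = (λ s → Adj-irrefl a (SameArc⇒base≡ s)) , x′ , r₁ x′ ,
                    base≡⇒SameArc (sym (base-flagAt (base x) (base y))) ,
                    base≡⇒SameArc (sym (trans (base-r₁ x′) (target-flagAt E))) , inj₂ refl
      where x′ = flagAt (base x) (base y)
    TrAdj⇒Adj : ∀ {x y} → TrAdj M x y → Adj (base x) (base y)
    TrAdj⇒Adj (_ , x′ , _ , sx , sy , inj₁ refl) = subst₂ Adj (sym (SameArc⇒base≡ sx))
      (trans (sym (base-r₀ x′)) (sym (SameArc⇒base≡ sy))) (Adj-partner (base x′))
    TrAdj⇒Adj (_ , x′ , _ , sx , sy , inj₂ refl) = subst₂ Adj (sym (SameArc⇒base≡ sx))
      (trans (sym (base-r₁ x′)) (sym (SameArc⇒base≡ sy))) (E₁⇒Adj (E₁-target x′))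

  module Automorphism (σ τ : V → V) (τσ : ∀ v → τ (σ v) ≡ v)
                      (σ-adj : ∀ a b → adj Γ (σ a) (σ b) ≡ adj Γ a b) where

    σ-injective : ∀ {a b} → σ a ≡ σ b → a ≡ b
    σ-injective {a} {b} e = trans (sym (τσ a)) (trans (cong τ e) (τσ b))

    Adj-σ : ∀ {a b} → Adj a b → Adj (σ a) (σ b)
    Adj-σ {a} {b} = trans (σ-adj a b)

    GirthCycle-σ : ∀ u ys w → GirthCycle (u ∷ ys ∷ʳ w) → GirthCycle (σ u ∷ map σ ys ∷ʳ σ w)
    GirthCycle-σ u ys w (len , 3≤ , C! , chain) = subst GirthCycle (cong (σ u ∷_) (map-++ σ ys (w ∷ [])))
      (trans (length-map σ C) len , subst (3 ≤_) (sym (length-map σ C)) 3≤ ,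
       Unique.map⁺ σ-injective C! , Chain-map σ Adj-σ C chain)
      where C = u ∷ ys ∷ʳ w

    private
      viaPartner : ∀ {u w} → E₁ u w → σ (partner u) ≡ partner (σ u) ⊎ σ w ≡ partner (σ u)
      viaPartner {u} {w} E = girthCycle-partner {mid = map σ (q ∷ rest)} (GirthCycle-σ u (partner u ∷ q ∷ rest) w C)
        where
        q = proj₁ (E₁-girthCycle E)
        rest = proj₁ (proj₂ (E₁-girthCycle E))
        C = proj₂ (proj₂ (E₁-girthCycle E))

    partner-σ : ∀ u → partner (σ u) ≡ σ (partner u)
    partner-σ u = [ sym , (λ e₁ → [ sym , (λ e₂ → ⊥-elim (O₁≢O₂ u (σ-injective (trans e₁ (sym e₂))))) ]′ (viaPartner (inj₂ refl))) ]′
                    (viaPartner (inj₁ refl))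

    E₁-σ : ∀ {u w} → E₁ u w → E₁ (σ u) (σ w)
    E₁-σ {u} E = E₁-intro (Adj-σ (E₁⇒Adj E)) (λ e → E₁⇒≢partner E (σ-injective (trans e (partner-σ u))))

    α : Flag → Flag
    α x = flagAt (σ (base x)) (σ (target x))

    base-α : ∀ x → base (α x) ≡ σ (base x)
    base-α x = base-flagAt (σ (base x)) (σ (target x))

    faceCycle-α : ∀ x → faceCycle (α x) ≡ map σ (faceCycle x)
    faceCycle-α x = begin
      faceCycle (α x)
        ≡⟨ faceCycle-unique {α x} {ys = map σ ys} (base-α x) (target-flagAt (E₁-σ (E₁-target x)))
                            (GirthCycle-σ (base x) ys (target x) (faceCycle-girth x)) ⟩
      σ (base x) ∷ map σ ys ∷ʳ σ (target x)
        ≡⟨ cong (σ (base x) ∷_) (map-++ σ ys (target x ∷ [])) ⟨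
      map σ (faceCycle x)
        ∎
      where
      open ≡-Reasoning
      ys = partner (base x) ∷ faceThird x ∷ faceRest x

    α-injective : ∀ {x y} → α x ≡ α y → x ≡ y
    α-injective {x} {y} e =
      faceCycle-injective (map-injective σ-injective (trans (sym (faceCycle-α x)) (trans (cong faceCycle e) (faceCycle-α y))))

    α-r₀ : ∀ x → α (r₀ x) ≡ r₀ (α x)
    α-r₀ x = faceCycle-injective (begin
      faceCycle (α (r₀ x))                         ≡⟨ faceCycle-α (r₀ x) ⟩
      map σ (faceCycle (r₀ x))                     ≡⟨ cong (map σ) (faceCycle-r₀ x) ⟩
      map σ (reverseFromSecond (faceCycle x))      ≡⟨ map-reverseFromSecond σ (faceCycle x) ⟩
      reverseFromSecond (map σ (faceCycle x))      ≡⟨ cong reverseFromSecond (sym (faceCycle-α x)) ⟩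
      reverseFromSecond (faceCycle (α x))          ≡⟨ sym (faceCycle-r₀ (α x)) ⟩
      faceCycle (r₀ (α x))                         ∎)
      where open ≡-Reasoning

    α-r₁ : ∀ x → α (r₁ x) ≡ r₁ (α x)
    α-r₁ x = faceCycle-injective (begin
      faceCycle (α (r₁ x))               ≡⟨ faceCycle-α (r₁ x) ⟩
      map σ (faceCycle (r₁ x))           ≡⟨ cong (map σ) (faceCycle-r₁ x) ⟩
      map σ (reverse (faceCycle x))      ≡⟨ reverse-map σ (faceCycle x) ⟩
      reverse (map σ (faceCycle x))      ≡⟨ cong reverse (sym (faceCycle-α x)) ⟩
      reverse (faceCycle (α x))          ≡⟨ sym (faceCycle-r₁ (α x)) ⟩
      faceCycle (r₁ (α x))               ∎)
      where open ≡-Reasoning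

    α-r₂ : ∀ x → α (r₂ x) ≡ r₂ (α x)
    α-r₂ x = [ (λ e → contradiction (α-injective e) (r₂-≢ x)) , id ]′
               (sameBase (trans (base-α (r₂ x)) (trans (cong σ (base-r₂ x)) (sym (base-α x)))))

  liftAutomorphism : (connected : Connected Γ) (σ τ : V → V) → (∀ v → τ (σ v) ≡ v) → (∀ v → σ (τ v) ≡ v) →
    (∀ a b → adj Γ (σ a) (σ b) ≡ adj Γ a b) → ∀ {x y} → σ (base x) ≡ base y →
    Σ (Flag → Flag) λ α → IsMapAut (flagMap connected) α × SameArc (flagMap connected) (α x) y
  liftAutomorphism _ σ τ τσ στ σ-adj {x} σx≡y =
    S.α , (T.α , T∘S , S∘T , S.α-r₀ , S.α-r₁ , S.α-r₂) , base≡⇒SameArc (trans (S.base-α x) σx≡y)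
    where
    module S = Automorphism σ τ τσ σ-adj
    module T = Automorphism τ σ στ (λ a b → trans (sym (σ-adj (τ a) (τ b))) (cong₂ (adj Γ) (στ a) (στ b)))
    T∘S : ∀ z → T.α (S.α z) ≡ z
    T∘S z = faceCycle-injective
      (trans (T.faceCycle-α (S.α z)) (trans (cong (map τ) (S.faceCycle-α z)) (map-inverse τσ (faceCycle z))))
    S∘T : ∀ z → S.α (T.α z) ≡ z
    S∘T z = faceCycle-injective
      (trans (S.faceCycle-α (T.α z)) (trans (cong (map σ) (T.faceCycle-α z)) (map-inverse στ (faceCycle z))))

  arcTransitive : (connected : Connected Γ) → VertexTransitive Γ → ArcTransitive (flagMap connected)
  arcTransitive connected vt x y =
    let σ , τ , τσ , στ , σ-adj , σx≡y = vt (base x) (base y) in liftAutomorphism connected σ τ τσ στ σ-adj σx≡y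

  -- Vertex degrees

  E₁-cycle-notGirth : ∀ {v vs} → Chain E₁ v (v ∷ vs) → ¬ GirthCycle (v ∷ vs)
  E₁-cycle-notGirth {v} {vs} chain C = split vs (GirthCycle-ends C) chain C
    where
    split : ∀ vs → (Σ V λ y → Σ (List V) λ mid → Σ V λ z → vs ≡ y ∷ mid ∷ʳ z) →
      Chain E₁ v (v ∷ vs) → ¬ GirthCycle (v ∷ vs)
    split _ (y , mid , z , refl) chain C =
      [ E₁⇒≢partner (proj₁ chain) , E₁⇒≢partner (E₁-sym (proj₂ (Chain-++⁻ E₁ (v ∷ y ∷ mid) z [] chain))) ]′
      (girthCycle-partner C)

  vertexRotation vertexRotation⁻¹ : Flag → Flag
  vertexRotation x   = r₂ (r₁ x)
  vertexRotation⁻¹ x = r₁ (r₂ x)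

  vertexRotation⁻¹-left : ∀ x → vertexRotation⁻¹ (vertexRotation x) ≡ x
  vertexRotation⁻¹-left x = trans (cong r₁ (r₂-involutive (r₁ x))) (r₁-involutive x)

  vertexRotation⁻¹-right : ∀ x → vertexRotation (vertexRotation⁻¹ x) ≡ x
  vertexRotation⁻¹-right x = trans (cong r₂ (r₁-involutive (r₂ x))) (r₂-involutive x)

  base-vertexRotation : ∀ x → base (vertexRotation x) ≡ target x
  base-vertexRotation x = trans (base-r₂ (r₁ x)) (base-r₁ x)

  -- The bases of the flags around a vertex of the map trace a closed walk of ε₁-edges that never turns back.
  module _ (x : Flag) where

    walk : ℕ → V
    walk k = base (iter vertexRotation k x)

    walk-E₁ : ∀ k → E₁ (walk k) (walk (suc k))
    walk-E₁ k = subst (E₁ (walk k)) (sym (base-vertexRotation (iter vertexRotation k x))) (E₁-target _)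

    walk-noBacktrack : ∀ k → walk (suc (suc k)) ≢ walk k
    walk-noBacktrack k e =
      target-r₂-≢ (r₁ z) (trans (sym (base-vertexRotation (vertexRotation z))) (trans e (sym (target-r₁ z))))
      where z = iter vertexRotation k x

    girth<vertexPeriod : ∀ {ℓ} → IsPeriod vertexRotation x ℓ → g < ℓ
    girth<vertexPeriod {ℓ} (0<ℓ , back , _) =
      shorter (closedWalk⇒cycle E₁⇒Adj walk walk-E₁ walk-noBacktrack 0<ℓ (cong base back))
      where
      shorter : (Σ V λ v → Σ (List V) λ vs → length (v ∷ vs) ≤ ℓ × Cycle (v ∷ vs) × Chain E₁ v (v ∷ vs)) → g < ℓ
      shorter (v , vs , |C|≤ℓ , cycle , chain) =
        <-≤-trans (≤∧≢⇒< (girth-minimal (v ∷ vs) cycle) (λ g≡ → E₁-cycle-notGirth chain (sym g≡ , cycle))) |C|≤ℓ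

  skeletonRegular : (connected : Connected Γ) → VertexTransitive Γ → ∀ {x ℓ} → IsPeriod vertexRotation x ℓ →
    SkeletonRegular (flagMap connected) ℓ
  skeletonRegular connected vt {x} {ℓ} periodic y = fromAutomorphism (arcTransitive connected vt x y)
    where
    M = flagMap connected
    fromAutomorphism : (Σ (Flag → Flag) λ α → IsMapAut M α × SameArc M (α x) y) → IsPeriod vertexRotation y ℓ
    fromAutomorphism (α , (β , βα , _ , _ , α-r₁ , α-r₂) , arc) = [ at-α , at-r₂α ]′ arc
      where
      periodic-α : IsPeriod vertexRotation (α x) ℓ
      periodic-α = IsPeriod-conj {f = vertexRotation} {f′ = vertexRotation} α β βα
                     (λ z → trans (α-r₂ (r₁ z)) (cong r₂ (α-r₁ z))) periodic
      at-α : y ≡ α x → IsPeriod vertexRotation y ℓ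
      at-α y≡ = subst (λ z → IsPeriod vertexRotation z ℓ) (sym y≡) periodic-α
      at-r₂α : y ≡ r₂ (α x) → IsPeriod vertexRotation y ℓ
      at-r₂α y≡ = subst (λ z → IsPeriod vertexRotation z ℓ) (sym y≡)
        (IsPeriod-conj {f = vertexRotation⁻¹} {f′ = vertexRotation} r₂ r₂ r₂-involutive (λ _ → refl)
          (IsPeriod-inverse {f = vertexRotation} {vertexRotation⁻¹}
            vertexRotation⁻¹-left vertexRotation⁻¹-right periodic-α))

theorem3p14 : ∀ {n g : ℕ} (Γ : Graph n) → Connected Γ → Cubic Γ → HasGirth Γ g → GirthRegular112 Γ g →
    (2 ∣ g)
    × (Σ ℕ λ N → Σ (Map N) λ M →
        FacesOfLength M (g / 2)
      × TrIso Γ M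
      × ((g / 2) ∣ n)
      × (VertexTransitive Γ → Σ ℕ λ ℓ → g < ℓ × SkeletonRegular M ℓ × FacesOfLength M (g / 2) × ArcTransitive M))
theorem3p14 {n} {g} Γ connected cubic hg signature =
  divides h (trans g≡2h (double≡*2 h)) ,
  n + n , flagMap connected , faces , truncation connected , subst (_∣ n) (sym g/2≡h) (half-girth∣n g≡2h) ,
  λ vt → ℓ , girth<vertexPeriod x₀ periodic , skeletonRegular connected vt periodic , faces , arcTransitive connected vt
  where
  open Signature112 Γ cubic hg signature
  open GraphCycles.Girth Γ hg using (someVertex)
  h = proj₁ girth-even
  g≡2h = proj₂ girth-even
  g/2≡h : g / 2 ≡ h
  g/2≡h = trans (cong (_/ 2) (trans g≡2h (double≡*2 h))) (m*n/n≡m h 2)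
  faces : FacesOfLength (flagMap connected) (g / 2)
  faces x = subst (IsPeriod ρ x) (sym g/2≡h) (facePeriod g≡2h x)
  x₀ = flag someVertex false
  ℓ = proj₁ (period vertexRotation vertexRotation⁻¹ vertexRotation⁻¹-left x₀)
  periodic = proj₂ (period vertexRotation vertexRotation⁻¹ vertexRotation⁻¹-left x₀)
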